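{- Let $G=(V,E)$ be a cubic Hamiltonian graph with $n$ vertices that contains at least one triangle, and let $C_0$ be a Hamiltonian cycle of $G$. Then either there exists a second Hamiltonian cycle $C_1\neq C_0$ of $G$ that contains exactly two edges not in $C_0$, or there exists a cubic Hamiltonian graph $G'$ with $n-2$ vertices such that the Hamiltonian cycles of $G$ correspond bijectively to the Hamiltonian cycles of $G'$ (or both).
   Context: Graphs are finite, simple, undirected; cubic means every vertex has degree $3$. A triangle is a cycle of length $3$. -}

module Defs where

open import Data.Nat using (ℕ; zero; suc; _<_; _≤_; _<ᵇ_; _∸_)
open import Data.Nat as ℕ using (_<?_)
open import Data.Fin using (Fin; toℕ; fromℕ<; zero) renaming (suc to fsuc)
open import Data.Vec using (Vec; lookup)
open import Data.Bool using (Bool; true; false; _∧_; not)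
open import Data.List using (List; length; filterᵇ; allFin; concatMap; map)
open import Data.Product using (Σ; ∃; _×_; _,_)
open import Data.Sum using (_⊎_)
open import Relation.Binary.PropositionalEquality using (_≡_)
open import Relation.Nullary using (yes; no)
open import Function.Definitions using (Injective)

EdgeSet : ℕ → Set
EdgeSet n = Vec (Vec Bool n) n

_∋[_,_] : ∀ {n} → EdgeSet n → Fin n → Fin n → Bool
E ∋[ u , v ] = lookup (lookup E u) v

record Graph (n : ℕ) : Set where
  field
    adj     : EdgeSet n
    symm    : ∀ u v → adj ∋[ u , v ] ≡ adj ∋[ v , u ]
    irrefl  : ∀ u → adj ∋[ u , u ] ≡ false
open Graph public

Adj : ∀ {n} → Graph n → Fin n → Fin n → Set
Adj G u v = adj G ∋[ u , v ] ≡ true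

degree : ∀ {n} → Graph n → Fin n → ℕ
degree {n} G u = length (filterᵇ (λ v → adj G ∋[ u , v ]) (allFin n))

Cubic : ∀ {n} → Graph n → Set
Cubic G = ∀ u → degree G u ≡ 3

HasTriangle : ∀ {n} → Graph n → Set
HasTriangle {n} G = Σ (Fin n) λ u → Σ (Fin n) λ v → Σ (Fin n) λ w →
  Adj G u v × Adj G v w × Adj G w u

next : ∀ {n} → Fin n → Fin n
next {suc m} i with toℕ i <? m
... | yes lt = fromℕ< (Data.Nat.s≤s lt)
... | no _   = zero

IsHamCycle : ∀ {n} → Graph n → EdgeSet n → Set
IsHamCycle {n} G H =
  3 ≤ n ×
  Σ (Fin n → Fin n) λ σ →
    Injective _≡_ _≡_ σ ×
    (∀ i → Adj G (σ i) (σ (next i))) ×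
    (∀ u v → (H ∋[ u , v ] ≡ true →
                 ∃ λ i → (u ≡ σ i × v ≡ σ (next i)) ⊎ (v ≡ σ i × u ≡ σ (next i)))
           × ((∃ λ i → (u ≡ σ i × v ≡ σ (next i)) ⊎ (v ≡ σ i × u ≡ σ (next i)))
                 → H ∋[ u , v ] ≡ true))

Hamiltonian : ∀ {n} → Graph n → Set
Hamiltonian {n} G = Σ (EdgeSet n) (IsHamCycle G)

pairs : (n : ℕ) → List (Fin n × Fin n)
pairs n = filterᵇ (λ p → toℕ (Data.Product.proj₁ p) <ᵇ toℕ (Data.Product.proj₂ p))
            (concatMap (λ u → map (λ v → (u , v)) (allFin n)) (allFin n))

newEdges : ∀ {n} → EdgeSet n → EdgeSet n → ℕ
newEdges {n} H K = length (filterᵇ (λ p → H ∋[ Data.Product.proj₁ p , Data.Product.proj₂ p ]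
                                          ∧ not (K ∋[ Data.Product.proj₁ p , Data.Product.proj₂ p ]))
                                   (pairs n))

HamBijection : ∀ {n m} → Graph n → Graph m → Set
HamBijection {n} {m} G G' =
  Σ (EdgeSet n → EdgeSet m) λ f → Σ (EdgeSet m → EdgeSet n) λ g →
    (∀ H → IsHamCycle G H → IsHamCycle G' (f H)) ×
    (∀ H' → IsHamCycle G' H' → IsHamCycle G (g H')) ×
    (∀ H → IsHamCycle G H → g (f H) ≡ H) ×
    (∀ H' → IsHamCycle G' H' → f (g H') ≡ H')

-- Let u v w be the triangle and a, c, b the third neighbours of u, v, w.
--
-- If two of a, b, c coincide, say a = c, then u v w a span a K₄ minus an edge.
-- Rotating C₀ suitably, it contains four consecutive vertices s₀ s₁ s₂ s₃ with
-- chords s₀s₂ and s₁s₃, and s₀ s₂ s₁ s₃ s₄ … is a Hamiltonian cycle differing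
-- from C₀ in exactly those two edges.
--
-- Otherwise contract the triangle to a single vertex t adjacent to a, b, c; the
-- result is cubic on n − 2 vertices.  A Hamiltonian cycle of G enters the
-- triangle once, runs through its three vertices and leaves, so contracting that
-- segment to t gives a Hamiltonian cycle of the contracted graph.  Conversely,
-- the two neighbours of t on a Hamiltonian cycle of the contracted graph are
-- pendant to two distinct triangle vertices, which forces the route through the
-- triangle; contraction and expansion are mutually inverse on Hamiltonian cycles.

module Submission where

open import Defs
open import Data.Nat using (ℕ; _∸_)
open import Data.Product using (Σ; _×_)
open import Data.Sum using (_⊎_)
open import Relation.Binary.PropositionalEquality using (_≡_; _≢_)

open import Data.Bool using (Bool; true; false; _∧_; _∨_; not; T)
import Data.Bool.Properties
open import Data.Empty using (⊥; ⊥-elim)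
open import Data.Fin as F using (Fin; toℕ; punchIn; punchOut; fromℕ<) renaming (zero to fz; suc to fs)
open import Data.Fin.Properties as FP using ()
open import Data.List using (List; []; _∷_; length; filterᵇ; allFin; tabulate; lookup; _++_; map; concatMap)
open import Data.List.Membership.Propositional.Properties using (∈-lookup)
open import Data.List.Relation.Unary.All as All using ([]; _∷_)
open import Data.List.Relation.Unary.AllPairs using (AllPairs; []; _∷_)
open import Data.Nat as N using (zero; suc; _+_; _*_; _<_; _≤_; z≤n; s≤s; NonZero; _%_)
open import Data.Nat.DivMod as DM using (_/_)
open import Data.Nat.Properties as NP using ()
open import Algebra.Properties.CommutativeSemigroup NP.+-commutativeSemigroup
  using (x∙yz≈y∙xz; x∙yz≈xz∙y; xy∙z≈xz∙y)
open import Data.Nat.Tactic.RingSolver using (solve-∀)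
open import Data.Product using (proj₁; proj₂; _,_; ∃)
open import Data.Sum using (inj₁; inj₂)
open import Data.Unit using (tt)
import Data.Vec as V
import Data.Vec.Properties as VP
open import Function using (_∘_; id)
open import Function.Definitions using (Injective)
open import Relation.Binary.Definitions using (Tri; tri<; tri≈; tri>)
open import Relation.Binary.PropositionalEquality
  using (refl; sym; trans; cong; cong₂; subst; subst₂; ≢-sym; module ≡-Reasoning)
open import Relation.Nullary using (¬_; Dec; yes; no; does)
open import Relation.Nullary.Decidable using (_×-dec_; _⊎-dec_)

open ≡-Reasoning

boolToℕ : Bool → ℕ
boolToℕ true = 1
boolToℕ false = 0

countImage : ∀ {N} k → (Fin k → Fin N) → (Fin N → Bool) → ℕ
countImage k f p = length (filterᵇ p (tabulate f))

countImage-suc : ∀ {N} k (f : Fin (suc k) → Fin N) p →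
  countImage (suc k) f p ≡ boolToℕ (p (f fz)) + countImage k (f ∘ fs) p
countImage-suc k f p with p (f fz)
... | true = refl
... | false = refl

countImage-cong : ∀ {N M} k (f : Fin k → Fin N) (g : Fin k → Fin M) p q →
  (∀ i → p (f i) ≡ q (g i)) → countImage k f p ≡ countImage k g q
countImage-cong zero f g p q e = refl
countImage-cong (suc k) f g p q e =
  trans (countImage-suc k f p) (trans (cong₂ _+_ (cong boolToℕ (e fz)) (countImage-cong k (f ∘ fs) (g ∘ fs) p q (e ∘ fs)))
    (sym (countImage-suc k g q)))

count : ∀ k → (Fin k → Bool) → ℕ
count k q = countImage k id q

count-cong : ∀ k (p q : Fin k → Bool) → (∀ i → p i ≡ q i) → count k p ≡ count k q
count-cong k p q e = countImage-cong k id id p q e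

count-suc : ∀ k (q : Fin (suc k) → Bool) → count (suc k) q ≡ boolToℕ (q fz) + count k (q ∘ fs)
count-suc k q = trans (countImage-suc k id q) (cong (boolToℕ (q fz) +_) (countImage-cong k fs id q (q ∘ fs) (λ i → refl)))

count-punchIn : ∀ k (i : Fin (suc k)) (q : Fin (suc k) → Bool) → count (suc k) q ≡ boolToℕ (q i) + count k (q ∘ punchIn i)
count-punchIn k fz q = count-suc k q
count-punchIn (suc k) (fs i) q =
  trans (count-suc (suc k) q) (trans (cong (boolToℕ (q fz) +_) (count-punchIn k i (q ∘ fs)))
   (trans (x∙yz≈y∙xz (boolToℕ (q fz)) (boolToℕ (q (fs i))) (count k (q ∘ fs ∘ punchIn i)))
     (cong (boolToℕ (q (fs i)) +_) (sym (count-suc k (q ∘ punchIn (fs i)))))))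

count-allFalse : ∀ k (q : Fin k → Bool) → (∀ i → q i ≡ false) → count k q ≡ 0
count-allFalse zero q h = refl
count-allFalse (suc k) q h = trans (count-suc k q) (trans (cong (λ b → boolToℕ b + count k (q ∘ fs)) (h fz)) (count-allFalse k (q ∘ fs) (h ∘ fs)))

count≡0⇒false : ∀ k (q : Fin k → Bool) → count k q ≡ 0 → ∀ i → q i ≡ false
count≡0⇒false (suc k) q h i with q i in eq
... | false = refl
... | true = ⊥-elim (contra (trans (sym (count-punchIn k i q)) h))
  where
  contra : boolToℕ (q i) + count k (q ∘ punchIn i) ≢ 0
  contra e rewrite eq with () ← e

count≢0⇒witness : ∀ k (q : Fin k → Bool) c → count k q ≡ suc c → ∃ λ i → q i ≡ true
count≢0⇒witness zero q c ()
count≢0⇒witness (suc k) q c h = go (q fz) refl (trans (sym (count-suc k q)) h)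
  where
  go : ∀ b → q fz ≡ b → boolToℕ b + count k (q ∘ fs) ≡ suc c → ∃ λ i → q i ≡ true
  go true e _ = fz , e
  go false e h' with count≢0⇒witness k (q ∘ fs) c h'
  ... | i , e' = fs i , e'

count-remove : ∀ k (q : Fin (suc k) → Bool) i c → q i ≡ true → count (suc k) q ≡ suc c → count k (q ∘ punchIn i) ≡ c
count-remove k q i c qi h = NP.suc-injective (trans (cong (λ b → boolToℕ b + count k (q ∘ punchIn i)) (sym qi)) (trans (sym (count-punchIn k i q)) h))

≢true⇒≡false : ∀ {b} → b ≢ true → b ≡ false
≢true⇒≡false {true} h = ⊥-elim (h refl)
≢true⇒≡false {false} h = refl

≡∨punchIn : ∀ {k} (i j : Fin (suc k)) → j ≡ i ⊎ ∃ λ j' → j ≡ punchIn i j'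
≡∨punchIn i j with i F.≟ j
... | yes e = inj₁ (sym e)
... | no ne = inj₂ (punchOut ne , sym (FP.punchIn-punchOut ne))

count≡1 : ∀ k (q : Fin k → Bool) p → q p ≡ true → (∀ i → q i ≡ true → i ≡ p) → count k q ≡ 1
count≡1 (suc k) q p qp ex = trans (count-punchIn k p q) (cong₂ _+_ (cong boolToℕ qp)
   (count-allFalse k (q ∘ punchIn p) (λ j → ≢true⇒≡false (λ h → FP.punchInᵢ≢i p j (ex _ h)))))

count≡2 : ∀ k (q : Fin k → Bool) p1 p2 → p1 ≢ p2 → q p1 ≡ true → q p2 ≡ true →
  (∀ i → q i ≡ true → i ≡ p1 ⊎ i ≡ p2) → count k q ≡ 2
count≡2 (suc k) q p1 p2 ne q1 q2 ex = trans (count-punchIn k p1 q) (cong₂ _+_ (cong boolToℕ q1)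
   (count≡1 k (q ∘ punchIn p1) (punchOut ne) (trans (cong q (FP.punchIn-punchOut ne)) q2)
      (λ j h → ex1 j (ex _ h))))
  where
  ex1 : ∀ j → punchIn p1 j ≡ p1 ⊎ punchIn p1 j ≡ p2 → j ≡ punchOut ne
  ex1 j (inj₁ e) = ⊥-elim (FP.punchInᵢ≢i p1 j e)
  ex1 j (inj₂ e) = FP.punchIn-injective p1 j _ (trans e (sym (FP.punchIn-punchOut ne)))

count≡3 : ∀ k (q : Fin k → Bool) p1 p2 p3 → p1 ≢ p2 → p1 ≢ p3 → p2 ≢ p3 → q p1 ≡ true → q p2 ≡ true → q p3 ≡ true →
  (∀ i → q i ≡ true → i ≡ p1 ⊎ i ≡ p2 ⊎ i ≡ p3) → count k q ≡ 3
count≡3 (suc k) q p1 p2 p3 n12 n13 n23 q1 q2 q3 ex = trans (count-punchIn k p1 q) (cong₂ _+_ (cong boolToℕ q1)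
   (count≡2 k (q ∘ punchIn p1) (punchOut n12) (punchOut n13)
      (λ e → n23 (trans (sym (FP.punchIn-punchOut n12)) (trans (cong (punchIn p1) e) (FP.punchIn-punchOut n13))))
      (trans (cong q (FP.punchIn-punchOut n12)) q2)
      (trans (cong q (FP.punchIn-punchOut n13)) q3)
      (λ j h → ex1 j (ex _ h))))
  where
  ex1 : ∀ j → punchIn p1 j ≡ p1 ⊎ punchIn p1 j ≡ p2 ⊎ punchIn p1 j ≡ p3 → j ≡ punchOut n12 ⊎ j ≡ punchOut n13
  ex1 j (inj₁ e) = ⊥-elim (FP.punchInᵢ≢i p1 j e)
  ex1 j (inj₂ (inj₁ e)) = inj₁ (FP.punchIn-injective p1 j _ (trans e (sym (FP.punchIn-punchOut n12))))
  ex1 j (inj₂ (inj₂ e)) = inj₂ (FP.punchIn-injective p1 j _ (trans e (sym (FP.punchIn-punchOut n13))))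

count≡3⇒third : ∀ k (q : Fin k → Bool) y z → y ≢ z → q y ≡ true → q z ≡ true → count k q ≡ 3 →
  ∃ λ a → q a ≡ true × a ≢ y × a ≢ z × (∀ i → q i ≡ true → i ≡ y ⊎ i ≡ z ⊎ i ≡ a)
count≡3⇒third (suc k) q y z ne qy qz h3 with count-remove k q y 2 qy h3
count≡3⇒third (suc (suc k)) q y z ne qy qz h3 | h2
  with count-remove k (q ∘ punchIn y) (punchOut ne) 1 (trans (cong q (FP.punchIn-punchOut ne)) qz) h2
... | h1 with count≢0⇒witness k (q ∘ punchIn y ∘ punchIn (punchOut ne)) 0 h1
count≡3⇒third (suc (suc (suc k))) q y z ne qy qz h3 | h2 | h1 | a'' , qa
  with count≡0⇒false k _ (count-remove k (q ∘ punchIn y ∘ punchIn (punchOut ne)) a'' 0 qa h1)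
... | h0 = a , qa , FP.punchInᵢ≢i y _ ,
           (λ e → FP.punchInᵢ≢i z' a'' (FP.punchIn-injective y _ _ (trans e (sym (FP.punchIn-punchOut ne))))) ,
           ex
  where
  z' = punchOut ne
  a = punchIn y (punchIn z' a'')
  ex : ∀ i → q i ≡ true → i ≡ y ⊎ i ≡ z ⊎ i ≡ a
  ex i qi with ≡∨punchIn y i
  ... | inj₁ e = inj₁ e
  ... | inj₂ (i1 , refl) with ≡∨punchIn z' i1
  ...   | inj₁ refl = inj₂ (inj₁ (FP.punchIn-punchOut ne))
  ...   | inj₂ (i2 , refl) with ≡∨punchIn a'' i2
  ...     | inj₁ refl = inj₂ (inj₂ refl)
  ...     | inj₂ (i3 , refl) with () ← trans (sym qi) (h0 i3)

-- Neighbourhoods in cubic graphs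

NbrsAmong : ∀ {n} → Graph n → Fin n → Fin n → Fin n → Fin n → Set
NbrsAmong G x α β γ = ∀ q → Adj G x q → q ≡ α ⊎ q ≡ β ⊎ q ≡ γ

NbrsAmong-swap₂₃ : ∀ {n} {G : Graph n} {x α β γ} → NbrsAmong G x α β γ → NbrsAmong G x α γ β
NbrsAmong-swap₂₃ h q a with h q a
... | inj₁ e = inj₁ e
... | inj₂ (inj₁ e) = inj₂ (inj₂ e)
... | inj₂ (inj₂ e) = inj₂ (inj₁ e)

NbrsAmong-swap₁₂ : ∀ {n} {G : Graph n} {x α β γ} → NbrsAmong G x α β γ → NbrsAmong G x β α γ
NbrsAmong-swap₁₂ h q a with h q a
... | inj₁ e = inj₂ (inj₁ e)
... | inj₂ (inj₁ e) = inj₁ e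
... | inj₂ (inj₂ e) = inj₂ (inj₂ e)

Adj-sym : ∀ {n} {G : Graph n} {x y} → Adj G x y → Adj G y x
Adj-sym {G = G} {x} {y} h = trans (symm G y x) h

Adj⇒≢ : ∀ {n} {G : Graph n} {x y} → Adj G x y → x ≢ y
Adj⇒≢ {G = G} {x} h refl with trans (sym (irrefl G x)) h
... | ()

record ThirdNbr {n} (G : Graph n) (x y z : Fin n) : Set where
  field
    nbr   : Fin n
    x~nbr : Adj G x nbr
    nbr≢y : nbr ≢ y
    nbr≢z : nbr ≢ z
    nbrs  : NbrsAmong G x y z nbr

cubic-thirdNbr : ∀ {n} (G : Graph n) → Cubic G → ∀ x y z → Adj G x y → Adj G x z → y ≢ z → ThirdNbr G x y z
cubic-thirdNbr {n} G cub x y z xy xz y≢z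
  with a , xa , a≢y , a≢z , nbrs ← count≡3⇒third n (λ q → adj G ∋[ x , q ]) y z y≢z xy xz (cub x)
  = record { nbr = a ; x~nbr = xa ; nbr≢y = a≢y ; nbr≢z = a≢z ; nbrs = nbrs }

lookup-injective : ∀ {A : Set} {xs : List A} → AllPairs _≢_ xs → Injective _≡_ _≡_ (lookup xs)
lookup-injective (x≢xs ∷ _) {fz} {fz} _ = refl
lookup-injective (x≢xs ∷ _) {fz} {fs j} eq = ⊥-elim (All.lookup x≢xs (∈-lookup j) eq)
lookup-injective (x≢xs ∷ _) {fs i} {fz} eq = ⊥-elim (All.lookup x≢xs (∈-lookup i) (sym eq))
lookup-injective (_ ∷ distinct) {fs i} {fs j} eq = cong fs (lookup-injective distinct eq)

distinct⇒length≤ : ∀ {n} {xs : List (Fin n)} → AllPairs _≢_ xs → length xs ≤ n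
distinct⇒length≤ distinct = FP.injective⇒≤ (lookup-injective distinct)

-- Tours

next-lt : ∀ {m} (i : Fin (suc m)) → suc (toℕ i) < suc m → toℕ (next i) ≡ suc (toℕ i)
next-lt {m} i h with toℕ i N.<? m
... | yes lt = FP.toℕ-fromℕ< (s≤s lt)
... | no nlt = ⊥-elim (nlt (NP.≤-pred h))

next-wrap : ∀ {m} (i : Fin (suc m)) → toℕ i ≡ m → next i ≡ fz
next-wrap {m} i h with toℕ i N.<? m
... | yes lt = ⊥-elim (NP.<-irrefl h lt)
... | no nlt = refl

next^ : ∀ {n} → ℕ → Fin n → Fin n
next^ zero x = x
next^ (suc k) x = next (next^ k x)

next^-+ : ∀ {n} a b (x : Fin n) → next^ (a + b) x ≡ next^ a (next^ b x)
next^-+ zero b x = refl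
next^-+ (suc a) b x = cong next (next^-+ a b x)

toℕ-next^-zero : ∀ {m} k → k < suc m → toℕ (next^ {suc m} k fz) ≡ k
toℕ-next^-zero zero h = refl
toℕ-next^-zero {m} (suc k) h = trans (next-lt (next^ k fz) (subst (λ z → suc z < suc m) (sym (toℕ-next^-zero k (NP.<-trans (NP.n<1+n k) h))) h))
                          (cong suc (toℕ-next^-zero k (NP.<-trans (NP.n<1+n k) h)))

next^-size : ∀ {m} → next^ {suc m} (suc m) fz ≡ fz
next^-size {m} = next-wrap (next^ m fz) (toℕ-next^-zero m (NP.n<1+n m))

next^-toℕ : ∀ {m} (i : Fin (suc m)) → next^ (toℕ i) fz ≡ i
next^-toℕ i = FP.toℕ-injective (toℕ-next^-zero (toℕ i) (FP.toℕ<n i))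

injective⇒surjective : ∀ {n} (f : Fin n → Fin n) → (∀ {i j} → f i ≡ f j → i ≡ j) → ∀ x → ∃ λ i → f i ≡ x
injective⇒surjective {zero} f fi ()
injective⇒surjective {suc m} f fi x with FP.any? (λ i → f i F.≟ x)
... | yes p = p
... | no np = ⊥-elim (NP.<-irrefl refl (FP.injective⇒≤ {f = g} ginj))
  where
  ne : ∀ i → x ≢ f i
  ne i e = np (i , sym e)
  g : Fin (suc m) → Fin m
  g i = punchOut (ne i)
  ginj : ∀ {i j} → g i ≡ g j → i ≡ j
  ginj {i} {j} e = fi (FP.punchOut-injective (ne i) (ne j) e)

SameEdge : ∀ {n} → Fin n → Fin n → Fin n → Fin n → Set
SameEdge x y p q = (x ≡ p × y ≡ q) ⊎ (y ≡ p × x ≡ q)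

SameEdge-cong : ∀ {n} {x y p q p' q' : Fin n} → p ≡ p' → q ≡ q' → SameEdge x y p q → SameEdge x y p' q'
SameEdge-cong refl refl e = e

SameEdge-swap : ∀ {n} {x y p q : Fin n} → SameEdge x y p q → SameEdge y x p q
SameEdge-swap (inj₁ (a , b)) = inj₂ (a , b)
SameEdge-swap (inj₂ (a , b)) = inj₁ (a , b)

-- Positions are natural numbers so that rotating the starting point is a shift.
record Tour {n} (G : Graph n) (H : EdgeSet n) : Set where
  field
    n≥3 : 3 ≤ n
    s : ℕ → Fin n
    period : ∀ k → s (k + n) ≡ s k
    inj : ∀ k l → k < n → l < n → s k ≡ s l → k ≡ l
    adjacent : ∀ k → Adj G (s k) (s (suc k))
    edge⇒step : ∀ x y → H ∋[ x , y ] ≡ true → ∃ λ k → SameEdge x y (s k) (s (suc k))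
    step⇒edge : ∀ x y k → SameEdge x y (s k) (s (suc k)) → H ∋[ x , y ] ≡ true

module TourProperties {n} {G : Graph n} {H : EdgeSet n} (c : Tour G H) where
  open Tour c public

  n' : ℕ
  n' = n ∸ 1

  suc-n'≡n : suc n' ≡ n
  suc-n'≡n = NP.m+[n∸m]≡n {1} {n} (NP.≤-trans (s≤s z≤n) n≥3)

  instance
    nzI : NonZero n
    nzI = N.>-nonZero (NP.≤-trans (s≤s z≤n) n≥3)

  s-+multiple : ∀ k q → s (k + q * n) ≡ s k
  s-+multiple k zero = cong s (NP.+-identityʳ k)
  s-+multiple k (suc q) = trans (cong s (x∙yz≈xz∙y k n (q * n))) (trans (period (k + q * n)) (s-+multiple k q))

  s-mod : ∀ k → s k ≡ s (k % n)
  s-mod k = trans (cong s (DM.m≡m%n+[m/n]*n k n)) (s-+multiple (k % n) (k / n))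

  s-mod-injective : ∀ {a b} → s a ≡ s b → a % n ≡ b % n
  s-mod-injective {a} {b} e = inj (a % n) (b % n) (DM.m%n<n a n) (DM.m%n<n b n) (trans (sym (s-mod a)) (trans e (s-mod b)))

  s-mod-cong : ∀ {a b} → a % n ≡ b % n → s a ≡ s b
  s-mod-cong {a} {b} e = trans (s-mod a) (trans (cong s e) (sym (s-mod b)))

  s-shift : ∀ {a b} c → s a ≡ s b → s (a + c) ≡ s (b + c)
  s-shift {a} {b} c e = s-mod-cong (trans (DM.%-distribˡ-+ a c n) (trans (cong (λ z → (z + c % n) % n) (s-mod-injective e)) (sym (DM.%-distribˡ-+ b c n))))

  s-unshift : ∀ {a b} c → s (a + c) ≡ s (b + c) → s a ≡ s b
  s-unshift {a} {b} c e =
    trans (sym (s-+multiple a c))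
     (trans (cong (λ z → s (a + c * z)) (sym suc-n'≡n))
      (trans (cong s (sym (reassoc a c n')))
       (trans (s-shift (c * n') e)
        (trans (cong s (reassoc b c n'))
         (trans (cong (λ z → s (b + c * z)) suc-n'≡n) (s-+multiple b c))))))
    where
    reassoc : ∀ a c n' → a + c + c * n' ≡ a + c * suc n'
    reassoc = solve-∀

  s-suc-cong : ∀ {a b} → s a ≡ s b → s (suc a) ≡ s (suc b)
  s-suc-cong {a} {b} e = trans (cong s (NP.+-comm 1 a)) (trans (s-shift 1 e) (cong s (NP.+-comm b 1)))

  s-rotate-back : ∀ k r → s (k + r * n' + r) ≡ s k
  s-rotate-back k r = trans (cong s (reassoc k r n')) (trans (cong (λ z → s (k + r * z)) suc-n'≡n) (s-+multiple k r))
    where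
    reassoc : ∀ k r n' → k + r * n' + r ≡ k + r * suc n'
    reassoc = solve-∀

  rotate : ℕ → Tour G H
  rotate r = record
    { n≥3 = n≥3
    ; s = λ k → s (k + r)
    ; period = λ k → trans (cong s (xy∙z≈xz∙y k n r)) (period (k + r))
    ; inj = λ k l k< l< e → inj k l k< l< (s-unshift r e)
    ; adjacent = λ k → adjacent (k + r)
    ; edge⇒step = λ x y h → let (k , e) = edge⇒step x y h in
        (k + r * n') , SameEdge-cong (sym (s-rotate-back k r)) (sym (s-rotate-back (suc k) r)) e
    ; step⇒edge = λ x y k e → step⇒edge x y (k + r) e
    }

  s-surjective : ∀ x → ∃ λ k → k < n × s k ≡ x
  s-surjective x with injective⇒surjective {n} (λ i → s (toℕ i)) (λ {i} {j} e → FP.toℕ-injective (inj (toℕ i) (toℕ j) (FP.toℕ<n i) (FP.toℕ<n j) e)) x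
  ... | i , e = toℕ i , FP.toℕ<n i , e

  prev : ℕ → ℕ
  prev j = j + n'

  s-suc-prev : ∀ j → s (suc (prev j)) ≡ s j
  s-suc-prev j = trans (cong s (trans (sym (NP.+-suc j n')) (cong (j +_) suc-n'≡n))) (period j)

  H-sym : ∀ {x y} → H ∋[ x , y ] ≡ true → H ∋[ y , x ] ≡ true
  H-sym {x} {y} h = let (k , e) = edge⇒step x y h in step⇒edge y x k (SameEdge-swap e)

  H-step : ∀ j → H ∋[ s j , s (suc j) ] ≡ true
  H-step j = step⇒edge _ _ j (inj₁ (refl , refl))

  H-prev : ∀ j → H ∋[ s j , s (prev j) ] ≡ true
  H-prev j = step⇒edge _ _ (prev j) (inj₂ (refl , sym (s-suc-prev j)))

  H⇒Adj : ∀ {x y} → H ∋[ x , y ] ≡ true → Adj G x y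
  H⇒Adj {x} {y} h with edge⇒step x y h
  ... | k , inj₁ (refl , refl) = adjacent k
  ... | k , inj₂ (refl , refl) = trans (symm G x y) (adjacent k)

  H-nbrs : ∀ j q → H ∋[ s j , q ] ≡ true → q ≡ s (suc j) ⊎ q ≡ s (prev j)
  H-nbrs j q h with edge⇒step (s j) q h
  ... | k , inj₁ (e1 , refl) = inj₁ (s-suc-cong (sym e1))
  ... | k , inj₂ (refl , e2) = inj₂ (trans (sym (s-suc-prev k)) (s-shift n' (sym e2)))

  s-distinct : ∀ a b → a < n → b < n → a ≢ b → s a ≢ s b
  s-distinct a b a< b< ne e = ne (inj a b a< b< e)

  s-suc≢s-prev : ∀ j → s (suc j) ≢ s (prev j)
  s-suc≢s-prev j e = s-distinct 2 0 (NP.≤-trans (s≤s (s≤s (s≤s z≤n))) n≥3) (NP.≤-trans (s≤s z≤n) n≥3) (λ ()) (s-unshift j (trans (s-suc-cong e) (s-suc-prev j)))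

  edge⇒step< : ∀ x y → H ∋[ x , y ] ≡ true → ∃ λ k → k < n × SameEdge x y (s k) (s (suc k))
  edge⇒step< x y h with edge⇒step x y h
  ... | k , e' = k % n , DM.m%n<n k n , SameEdge-cong (s-mod k) (trans (s-suc-cong (s-mod k)) refl) e'

  H-irrefl : ∀ x → H ∋[ x , x ] ≡ false
  H-irrefl x = ≢true⇒≡false (λ h → Adj⇒≢ {G = G} (H⇒Adj h) refl)

  H-misses-two : ∀ z α β γ → NbrsAmong G z α β γ → H ∋[ z , α ] ≢ true → H ∋[ z , β ] ≢ true → ⊥
  H-misses-two z α β γ nz hα hβ with s-surjective z
  ... | j , _ , refl = s-suc≢s-prev j (trans (f (s (suc j)) (H-step j)) (sym (f (s (prev j)) (H-prev j))))
    where
    f : ∀ q → H ∋[ s j , q ] ≡ true → q ≡ γ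
    f q h with nz q (H⇒Adj h)
    ... | inj₁ refl = ⊥-elim (hα h)
    ... | inj₂ (inj₁ refl) = ⊥-elim (hβ h)
    ... | inj₂ (inj₂ e) = e

  H-nbrs-suc : ∀ k q → H ∋[ s (suc k) , q ] ≡ true → q ≡ s (suc (suc k)) ⊎ q ≡ s k
  H-nbrs-suc k q h with H-nbrs (suc k) q h
  ... | inj₁ e = inj₁ e
  ... | inj₂ e = inj₂ (trans e (s-suc-prev k))

  ¬H-suc : ∀ k z → z ≢ s (suc (suc k)) → z ≢ s k → H ∋[ z , s (suc k) ] ≢ true
  ¬H-suc k z n1 n2 h with H-nbrs-suc k z (H-sym h)
  ... | inj₁ e = n1 e
  ... | inj₂ e = n2 e

fromIsHamCycle : ∀ {n} {G : Graph n} {H : EdgeSet n} → IsHamCycle G H → Tour G H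
fromIsHamCycle {zero} (() , _)
fromIsHamCycle {suc m} {G} {H} (h3 , σ , σinj , adjσ , ch) = record
  { n≥3 = h3
  ; s = s
  ; period = λ k → cong σ (trans (next^-+ k (suc m) fz) (cong (next^ k) next^-size))
  ; inj = λ k l k< l< e → trans (sym (toℕ-next^-zero k k<)) (trans (cong toℕ (σinj e)) (toℕ-next^-zero l l<))
  ; adjacent = λ k → adjσ (next^ k fz)
  ; edge⇒step = λ x y h → let (i , e) = proj₁ (ch x y) h in
      toℕ i , SameEdge-cong (cong σ (sym (next^-toℕ i))) (cong (σ ∘ next) (sym (next^-toℕ i))) e
  ; step⇒edge = λ x y k e → proj₂ (ch x y) (next^ k fz , e)
  }
  where
  s : ℕ → Fin (suc m)
  s k = σ (next^ k fz)

toIsHamCycle : ∀ {n} {G : Graph n} {H : EdgeSet n} → Tour G H → IsHamCycle G H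
toIsHamCycle {zero} c with () ← Tour.n≥3 c
toIsHamCycle {suc m} {G} {H} c = n≥3 , σ , (λ {i} {j} e → FP.toℕ-injective (inj (toℕ i) (toℕ j) (FP.toℕ<n i) (FP.toℕ<n j) e)) ,
    (λ i → subst (λ z → Adj G (σ i) z) (sym (sn i)) (adjacent (toℕ i))) ,
    λ x y → (λ h → let (k , e) = edge⇒step x y h in
               fromℕ< (DM.m%n<n k (suc m)) ,
               SameEdge-cong (trans (s-mod k) (cong s (sym (FP.toℕ-fromℕ< (DM.m%n<n k (suc m))))))
                       (trans (s-suc-cong (s-mod k)) (trans (cong (s ∘ suc) (sym (FP.toℕ-fromℕ< (DM.m%n<n k (suc m))))) (sym (sn _)))) e) ,
            (λ { (i , e) → step⇒edge x y (toℕ i) (SameEdge-cong refl (sn i) e) })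
  where
  open TourProperties c
  σ : Fin (suc m) → Fin (suc m)
  σ i = s (toℕ i)
  sn : ∀ i → s (toℕ (next i)) ≡ s (suc (toℕ i))
  sn i with suc (toℕ i) N.<? suc m
  ... | yes lt = cong s (next-lt i lt)
  ... | no nlt = trans (cong s (trans (cong toℕ (next-wrap i eqm)) refl)) (trans (sym (period 0)) (cong (s ∘ suc) (sym eqm)))
    where
    eqm : toℕ i ≡ m
    eqm = NP.≤-antisym (NP.≤-pred (FP.toℕ<n i)) (NP.≤-pred (NP.≮⇒≥ nlt))

CyclicStep : ∀ {n} → ℕ → (ℕ → Fin n) → Fin n → Fin n → Set
CyclicStep len φ x y = (∃ λ j → suc j < len × SameEdge x y (φ j) (φ (suc j)))
                     ⊎ (∃ λ j → suc j ≡ len × SameEdge x y (φ j) (φ 0))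

CyclicStep-swap : ∀ {n len φ} {x y : Fin n} → CyclicStep len φ x y → CyclicStep len φ y x
CyclicStep-swap (inj₁ (j , l , e)) = inj₁ (j , l , SameEdge-swap e)
CyclicStep-swap (inj₂ (j , l , e)) = inj₂ (j , l , SameEdge-swap e)

suc-mod-cases : ∀ n0 k → (suc k % suc (suc n0) ≡ suc (k % suc (suc n0)) × suc (k % suc (suc n0)) < suc (suc n0))
                 ⊎ (suc (k % suc (suc n0)) ≡ suc (suc n0) × suc k % suc (suc n0) ≡ 0)
suc-mod-cases n0 k with suc (k % n) N.<? n
  where n = suc (suc n0)
... | yes lt = inj₁ (trans (DM.%-distribˡ-+ 1 k (suc (suc n0))) (DM.m<n⇒m%n≡m lt) , lt)
... | no nlt = inj₂ (eq , trans (DM.%-distribˡ-+ 1 k (suc (suc n0))) (trans (cong (_% suc (suc n0)) eq) (DM.n%n≡0 (suc (suc n0)))))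
  where
  eq : suc (k % suc (suc n0)) ≡ suc (suc n0)
  eq = NP.≤-antisym (DM.m%n<n k (suc (suc n0))) (NP.≮⇒≥ nlt)

tourFromPath : ∀ n0 (G : Graph (suc (suc n0))) (K : EdgeSet (suc (suc n0))) → 3 ≤ suc (suc n0) →
  (φ : ℕ → Fin (suc (suc n0))) →
  (∀ a b → a < suc (suc n0) → b < suc (suc n0) → φ a ≡ φ b → a ≡ b) →
  (∀ j → suc j < suc (suc n0) → Adj G (φ j) (φ (suc j))) →
  (∀ j → suc j ≡ suc (suc n0) → Adj G (φ j) (φ 0)) →
  (∀ x y → K ∋[ x , y ] ≡ true → CyclicStep (suc (suc n0)) φ x y) →
  (∀ x y j → suc j < suc (suc n0) → SameEdge x y (φ j) (φ (suc j)) → K ∋[ x , y ] ≡ true) →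
  (∀ x y j → suc j ≡ suc (suc n0) → SameEdge x y (φ j) (φ 0) → K ∋[ x , y ] ≡ true) →
  Tour G K
tourFromPath n0 G K h3 φ φinj φadj φwrap edge⇒cyclicStep pathStep⇒edge closingStep⇒edge = record
  { n≥3 = h3
  ; s = s
  ; period = λ k → cong φ (DM.[m+n]%n≡m%n k n)
  ; inj = λ k l k< l< e → trans (sym (DM.m<n⇒m%n≡m k<)) (trans (φinj _ _ (DM.m%n<n k n) (DM.m%n<n l n) e) (DM.m<n⇒m%n≡m l<))
  ; adjacent = adjacent
  ; edge⇒step = edge⇒step
  ; step⇒edge = step⇒edge
  }
  where
  n = suc (suc n0)
  s : ℕ → Fin n
  s k = φ (k % n)
  adjacent : ∀ k → Adj G (s k) (s (suc k))
  adjacent k with suc-mod-cases n0 k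
  ... | inj₁ (e , lt) rewrite e = φadj (k % n) lt
  ... | inj₂ (e , e0) rewrite e0 = φwrap (k % n) e
  edge⇒step : ∀ x y → K ∋[ x , y ] ≡ true → ∃ λ k → SameEdge x y (s k) (s (suc k))
  edge⇒step x y h with edge⇒cyclicStep x y h
  ... | inj₁ (j , lt , e) = j , SameEdge-cong (cong φ (sym (DM.m<n⇒m%n≡m (NP.<-trans (NP.n<1+n j) lt)))) (cong φ (sym (DM.m<n⇒m%n≡m lt))) e
  ... | inj₂ (j , eq , e) = j , SameEdge-cong (cong φ (sym (DM.m<n⇒m%n≡m (NP.≤-reflexive eq))))
                                        (cong φ (sym (trans (cong (_% n) eq) (DM.n%n≡0 n)))) e
  step⇒edge : ∀ x y k → SameEdge x y (s k) (s (suc k)) → K ∋[ x , y ] ≡ true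
  step⇒edge x y k e with suc-mod-cases n0 k
  ... | inj₁ (e1 , lt) rewrite e1 = pathStep⇒edge x y (k % n) lt e
  ... | inj₂ (e1 , e0) rewrite e0 = closingStep⇒edge x y (k % n) e1 e

-- Counting new edges

T⇒≡true : ∀ {b} → T b → b ≡ true
T⇒≡true {true} _ = refl

≡true⇒T : ∀ {b} → b ≡ true → T b
≡true⇒T refl = tt

∧≡true⇒ : ∀ {a b} → a ∧ b ≡ true → a ≡ true × b ≡ true
∧≡true⇒ {true} {true} _ = refl , refl

countᴸ : ∀ {A : Set} → (A → Bool) → List A → ℕ
countᴸ P xs = length (filterᵇ P xs)

countᴸ-filter : ∀ {A : Set} (P Q : A → Bool) xs → countᴸ P (filterᵇ Q xs) ≡ countᴸ (λ x → Q x ∧ P x) xs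
countᴸ-filter P Q [] = refl
countᴸ-filter P Q (x ∷ xs) with Q x
... | false = countᴸ-filter P Q xs
... | true with P x
...   | true = cong suc (countᴸ-filter P Q xs)
...   | false = countᴸ-filter P Q xs

countᴸ-++ : ∀ {A : Set} (P : A → Bool) xs ys → countᴸ P (xs ++ ys) ≡ countᴸ P xs + countᴸ P ys
countᴸ-++ P [] ys = refl
countᴸ-++ P (x ∷ xs) ys with P x
... | true = cong suc (countᴸ-++ P xs ys)
... | false = countᴸ-++ P xs ys

countᴸ-map : ∀ {A B : Set} (P : B → Bool) (g : A → B) xs → countᴸ P (map g xs) ≡ countᴸ (P ∘ g) xs
countᴸ-map P g [] = refl
countᴸ-map P g (x ∷ xs) with P (g x)
... | true = cong suc (countᴸ-map P g xs)
... | false = countᴸ-map P g xs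

sumᴸ : ∀ {A : Set} → List A → (A → ℕ) → ℕ
sumᴸ [] g = 0
sumᴸ (x ∷ xs) g = g x + sumᴸ xs g

countᴸ-concatMap : ∀ {A B : Set} (P : B → Bool) (f : A → List B) xs → countᴸ P (concatMap f xs) ≡ sumᴸ xs (λ x → countᴸ P (f x))
countᴸ-concatMap P f [] = refl
countᴸ-concatMap P f (x ∷ xs) = trans (countᴸ-++ P (f x) (concatMap f xs)) (cong (countᴸ P (f x) +_) (countᴸ-concatMap P f xs))

sumImage : ∀ {N} k → (Fin k → Fin N) → (Fin N → ℕ) → ℕ
sumImage k f g = sumᴸ (tabulate f) g

sumImage-cong : ∀ {N M} k (f : Fin k → Fin N) (f' : Fin k → Fin M) g g' → (∀ i → g (f i) ≡ g' (f' i)) → sumImage k f g ≡ sumImage k f' g'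
sumImage-cong zero f f' g g' e = refl
sumImage-cong (suc k) f f' g g' e = cong₂ _+_ (e fz) (sumImage-cong k (f ∘ fs) (f' ∘ fs) g g' (e ∘ fs))

sumᶠ : ∀ k → (Fin k → ℕ) → ℕ
sumᶠ k g = sumImage k id g

sumᶠ-suc : ∀ k (g : Fin (suc k) → ℕ) → sumᶠ (suc k) g ≡ g fz + sumᶠ k (g ∘ fs)
sumᶠ-suc k g = cong (g fz +_) (sumImage-cong k fs id g (g ∘ fs) (λ i → refl))

sumᶠ-punchIn : ∀ k (i : Fin (suc k)) (g : Fin (suc k) → ℕ) → sumᶠ (suc k) g ≡ g i + sumᶠ k (g ∘ punchIn i)
sumᶠ-punchIn k fz g = sumᶠ-suc k g
sumᶠ-punchIn (suc k) (fs i) g =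
  trans (sumᶠ-suc (suc k) g) (trans (cong (g fz +_) (sumᶠ-punchIn k i (g ∘ fs)))
   (trans (x∙yz≈y∙xz (g fz) (g (fs i)) (sumᶠ k (g ∘ fs ∘ punchIn i)))
     (cong (g (fs i) +_) (sym (sumᶠ-suc k (g ∘ punchIn (fs i)))))))

sumᶠ-zero : ∀ k (g : Fin k → ℕ) → (∀ i → g i ≡ 0) → sumᶠ k g ≡ 0
sumᶠ-zero zero g h = refl
sumᶠ-zero (suc k) g h = trans (sumᶠ-suc k g) (cong₂ _+_ (h fz) (sumᶠ-zero k (g ∘ fs) (h ∘ fs)))

sumᴸ-cong : ∀ {A : Set} (xs : List A) (g g' : A → ℕ) → (∀ x → g x ≡ g' x) → sumᴸ xs g ≡ sumᴸ xs g'
sumᴸ-cong [] g g' e = refl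
sumᴸ-cong (x ∷ xs) g g' e = cong₂ _+_ (e x) (sumᴸ-cong xs g g' e)

lessᵇ : ∀ {n} → Fin n → Fin n → Bool
lessᵇ u v = toℕ u N.<ᵇ toℕ v

countᴸ-pairs : ∀ n (P : Fin n × Fin n → Bool) → countᴸ P (pairs n) ≡ sumᶠ n (λ u → count n (λ v → lessᵇ u v ∧ P (u , v)))
countᴸ-pairs n P = trans (countᴸ-filter P _ L) (trans (countᴸ-concatMap _ _ (allFin n))
    (sumᴸ-cong (allFin n) _ _ (λ u → countᴸ-map _ (u ,_) (allFin n))))
  where
  L = concatMap (λ u → map (λ v → (u , v)) (allFin n)) (allFin n)

orient : ∀ {n} (x y : Fin n) → x ≢ y → Σ (Fin n) λ a → Σ (Fin n) λ b → toℕ a < toℕ b × ((a ≡ x × b ≡ y) ⊎ (a ≡ y × b ≡ x))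
orient x y ne with toℕ x N.<? toℕ y
... | yes lt = x , y , lt , inj₁ (refl , refl)
... | no nlt = y , x , NP.≤∧≢⇒< (NP.≮⇒≥ nlt) (λ e → ne (FP.toℕ-injective (sym e))) , inj₂ (refl , refl)

orient-unique : ∀ {n} {u v x y a b : Fin n} → toℕ u < toℕ v → SameEdge u v x y → toℕ a < toℕ b →
  (a ≡ x × b ≡ y) ⊎ (a ≡ y × b ≡ x) → u ≡ a × v ≡ b
orient-unique uv (inj₁ (refl , refl)) ab (inj₁ (refl , refl)) = refl , refl
orient-unique uv (inj₁ (refl , refl)) ab (inj₂ (refl , refl)) = ⊥-elim (NP.<-asym uv ab)
orient-unique uv (inj₂ (refl , refl)) ab (inj₁ (refl , refl)) = ⊥-elim (NP.<-asym uv ab)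
orient-unique uv (inj₂ (refl , refl)) ab (inj₂ (refl , refl)) = refl , refl

orient⇒SameEdge : ∀ {n} {x y a b : Fin n} → (a ≡ x × b ≡ y) ⊎ (a ≡ y × b ≡ x) → SameEdge a b x y
orient⇒SameEdge (inj₁ (refl , refl)) = inj₁ (refl , refl)
orient⇒SameEdge (inj₂ (refl , refl)) = inj₂ (refl , refl)

orient-SameEdge : ∀ {n} {x1 y1 x2 y2 a b : Fin n} → (a ≡ x1 × b ≡ y1) ⊎ (a ≡ y1 × b ≡ x1) → (a ≡ x2 × b ≡ y2) ⊎ (a ≡ y2 × b ≡ x2) → SameEdge x1 y1 x2 y2
orient-SameEdge (inj₁ (refl , refl)) (inj₁ (refl , refl)) = inj₁ (refl , refl)
orient-SameEdge (inj₁ (refl , refl)) (inj₂ (refl , refl)) = inj₂ (refl , refl)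
orient-SameEdge (inj₂ (refl , refl)) (inj₁ (refl , refl)) = inj₂ (refl , refl)
orient-SameEdge (inj₂ (refl , refl)) (inj₂ (refl , refl)) = inj₁ (refl , refl)

sumᶠ-punchIn² : ∀ k (i : Fin (suc (suc k))) (j : Fin (suc k)) g → sumᶠ (suc (suc k)) g ≡ g i + (g (punchIn i j) + sumᶠ k (g ∘ punchIn i ∘ punchIn j))
sumᶠ-punchIn² k i j g = trans (sumᶠ-punchIn (suc k) i g) (cong (g i +_) (sumᶠ-punchIn k j (g ∘ punchIn i)))

Fin1-≡ : ∀ (x y : Fin 1) → x ≡ y
Fin1-≡ fz fz = refl

countᴸ-pairs≡2 : ∀ n (P : Fin n × Fin n → Bool) (x1 y1 x2 y2 : Fin n) → x1 ≢ y1 → x2 ≢ y2 → ¬ SameEdge x1 y1 x2 y2 →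
  (∀ x y → P (x , y) ≡ true → SameEdge x y x1 y1 ⊎ SameEdge x y x2 y2) →
  (∀ x y → SameEdge x y x1 y1 ⊎ SameEdge x y x2 y2 → P (x , y) ≡ true) →
  countᴸ P (pairs n) ≡ 2
countᴸ-pairs≡2 zero P () 
countᴸ-pairs≡2 (suc zero) P x1 y1 x2 y2 ne1 = ⊥-elim (ne1 (Fin1-≡ x1 y1))
countᴸ-pairs≡2 (suc (suc k)) P x1 y1 x2 y2 ne1 ne2 nE P⇒ P⇐ with orient x1 y1 ne1 | orient x2 y2 ne2
... | a1 , b1 , lt1 , o1 | a2 , b2 , lt2 , o2 = trans (countᴸ-pairs n P) main
  where
  n = suc (suc k)
  Q : Fin n → Fin n → Bool
  Q u v = lessᵇ u v ∧ P (u , v)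
  Q⇒ : ∀ u v → Q u v ≡ true → (u ≡ a1 × v ≡ b1) ⊎ (u ≡ a2 × v ≡ b2)
  Q⇒ u v h with ∧≡true⇒ {lessᵇ u v} h
  ... | l , p with P⇒ u v p
  ...   | inj₁ e = inj₁ (orient-unique (NP.<ᵇ⇒< _ _ (≡true⇒T l)) e lt1 o1)
  ...   | inj₂ e = inj₂ (orient-unique (NP.<ᵇ⇒< _ _ (≡true⇒T l)) e lt2 o2)
  Q1 : Q a1 b1 ≡ true
  Q1 rewrite T⇒≡true (NP.<⇒<ᵇ lt1) = P⇐ a1 b1 (inj₁ (orient⇒SameEdge o1))
  Q2 : Q a2 b2 ≡ true
  Q2 rewrite T⇒≡true (NP.<⇒<ᵇ lt2) = P⇐ a2 b2 (inj₂ (orient⇒SameEdge o2))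
  g : Fin n → ℕ
  g u = count n (Q u)
  main : sumᶠ n g ≡ 2
  main with a1 F.≟ a2
  main | yes refl = trans (sumᶠ-punchIn (suc k) a1 g) (cong₂ _+_ g1 (sumᶠ-zero (suc k) _ (λ j → count-allFalse _ _ (λ v → ≢true⇒≡false (λ h → rest j v h)))))
    where
    b12 : b1 ≢ b2
    b12 refl = nE (orient-SameEdge o1 o2)
    g1 : g a1 ≡ 2
    g1 = count≡2 _ (Q a1) b1 b2 b12 Q1 Q2 (λ v h → Data.Sum.map proj₂ proj₂ (Q⇒ a1 v h))
    rest : ∀ j v → Q (punchIn a1 j) v ≡ true → ⊥
    rest j v h with Q⇒ _ v h
    ... | inj₁ (e , _) = FP.punchInᵢ≢i a1 j e
    ... | inj₂ (e , _) = FP.punchInᵢ≢i a1 j e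
  main | no a12 = trans (sumᶠ-punchIn² k a1 a2' g) (cong₂ _+_ g1 (cong₂ _+_ g2 (sumᶠ-zero k _ λ j → count-allFalse _ _ (λ v → ≢true⇒≡false (λ h → rest j v h)))))
    where
    a2' : Fin (suc k)
    a2' = punchOut a12
    pa : punchIn a1 a2' ≡ a2
    pa = FP.punchIn-punchOut a12
    g1 : g a1 ≡ 1
    g1 = count≡1 _ (Q a1) b1 Q1 (λ v h → f (Q⇒ a1 v h))
      where
      f : ∀ {v} → (a1 ≡ a1 × v ≡ b1) ⊎ (a1 ≡ a2 × v ≡ b2) → v ≡ b1
      f (inj₁ (_ , e)) = e
      f (inj₂ (e , _)) = ⊥-elim (a12 e)
    g2 : g (punchIn a1 a2') ≡ 1
    g2 rewrite pa = count≡1 _ (Q a2) b2 Q2 (λ v h → f (Q⇒ a2 v h))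
      where
      f : ∀ {v} → (a2 ≡ a1 × v ≡ b1) ⊎ (a2 ≡ a2 × v ≡ b2) → v ≡ b2
      f (inj₂ (_ , e)) = e
      f (inj₁ (e , _)) = ⊥-elim (a12 (sym e))
    rest : ∀ j v → Q (punchIn a1 (punchIn a2' j)) v ≡ true → ⊥
    rest j v h with Q⇒ _ v h
    ... | inj₁ (e , _) = FP.punchInᵢ≢i a1 _ e
    ... | inj₂ (e , _) = FP.punchInᵢ≢i a2' j (FP.punchIn-injective a1 _ _ (trans e (sym pa)))

tabulate² : ∀ {n} → (Fin n → Fin n → Bool) → EdgeSet n
tabulate² F = V.tabulate (λ x → V.tabulate (λ y → F x y))

lookup-tabulate² : ∀ {n} (F : Fin n → Fin n → Bool) x y → tabulate² F ∋[ x , y ] ≡ F x y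
lookup-tabulate² F x y = trans (cong (λ r → V.lookup r y) (VP.lookup∘tabulate _ x)) (VP.lookup∘tabulate _ y)

SameEdge? : ∀ {n} (x y p q : Fin n) → Dec (SameEdge x y p q)
SameEdge? x y p q = ((x F.≟ p) ×-dec (y F.≟ q)) ⊎-dec ((y F.≟ p) ×-dec (x F.≟ q))

any?⇒∃ : ∀ {n} {P : Fin n → Set} (P? : ∀ i → Dec (P i)) → does (FP.any? P?) ≡ true → ∃ P
any?⇒∃ P? h with FP.any? P?
... | yes p = p
any?⇒∃ P? () | no _

∃⇒any? : ∀ {n} {P : Fin n → Set} (P? : ∀ i → Dec (P i)) → ∃ P → does (FP.any? P?) ≡ true
∃⇒any? P? p with FP.any? P?
... | yes _ = refl
... | no np = ⊥-elim (np p)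

SameEdge-flip : ∀ {n} {x y p q : Fin n} → SameEdge x y p q → SameEdge x y q p
SameEdge-flip (inj₁ (a , b)) = inj₂ (b , a)
SameEdge-flip (inj₂ (a , b)) = inj₁ (b , a)

not≡true⇒≡false : ∀ {b} → not b ≡ true → b ≡ false
not≡true⇒≡false {false} _ = refl

≡false⇒not≡true : ∀ {b} → b ≡ false → not b ≡ true
≡false⇒not≡true refl = refl

module PathEdges (n0 : ℕ) (φ : ℕ → Fin (suc (suc n0))) where
  n = suc (suc n0)

  P? : ∀ x y (i : Fin n) → Dec (SameEdge x y (φ (toℕ i)) (φ (suc (toℕ i) % n)))
  P? x y i = SameEdge? x y (φ (toℕ i)) (φ (suc (toℕ i) % n))

  isPathEdge : Fin n → Fin n → Bool
  isPathEdge x y = does (FP.any? (P? x y))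

  K : EdgeSet n
  K = tabulate² isPathEdge

  edge⇒cyclicStep : ∀ x y → K ∋[ x , y ] ≡ true → CyclicStep n φ x y
  edge⇒cyclicStep x y h with any?⇒∃ (P? x y) (trans (sym (lookup-tabulate² isPathEdge x y)) h)
  ... | i , e with suc (toℕ i) N.<? n
  ...   | yes lt = inj₁ (toℕ i , lt , SameEdge-cong refl (cong φ (DM.m<n⇒m%n≡m lt)) e)
  ...   | no nlt = inj₂ (toℕ i , eq , SameEdge-cong refl (cong φ (trans (cong (_% n) eq) (DM.n%n≡0 n))) e)
    where
    eq : suc (toℕ i) ≡ n
    eq = NP.≤-antisym (FP.toℕ<n i) (NP.≮⇒≥ nlt)

  pathStep⇒edge : ∀ x y j → suc j < n → SameEdge x y (φ j) (φ (suc j)) → K ∋[ x , y ] ≡ true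
  pathStep⇒edge x y j lt e = trans (lookup-tabulate² isPathEdge x y) (∃⇒any? (P? x y) (i , SameEdge-cong (cong φ (sym ti)) (cong φ e2) e))
    where
    i : Fin n
    i = fromℕ< (NP.<-trans (NP.n<1+n j) lt)
    ti : toℕ i ≡ j
    ti = FP.toℕ-fromℕ< (NP.<-trans (NP.n<1+n j) lt)
    e2 : suc j ≡ suc (toℕ i) % n
    e2 = trans (sym (DM.m<n⇒m%n≡m lt)) (cong (λ z → suc z % n) (sym ti))

  closingStep⇒edge : ∀ x y j → suc j ≡ n → SameEdge x y (φ j) (φ 0) → K ∋[ x , y ] ≡ true
  closingStep⇒edge x y j eq e = trans (lookup-tabulate² isPathEdge x y) (∃⇒any? (P? x y) (i , SameEdge-cong (cong φ (sym ti)) (cong φ e2) e))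
    where
    i : Fin n
    i = fromℕ< (NP.≤-reflexive eq)
    ti : toℕ i ≡ j
    ti = FP.toℕ-fromℕ< (NP.≤-reflexive eq)
    e2 : 0 ≡ suc (toℕ i) % n
    e2 = trans (sym (DM.n%n≡0 n)) (cong (_% n) (trans (sym eq) (cong suc (sym ti))))

-- Switching along crossed chords

swap₁₂ : ℕ → ℕ
swap₁₂ (suc zero) = 2
swap₁₂ (suc (suc zero)) = 1
swap₁₂ j = j

swap₁₂-involutive : ∀ j → swap₁₂ (swap₁₂ j) ≡ j
swap₁₂-involutive zero = refl
swap₁₂-involutive (suc zero) = refl
swap₁₂-involutive (suc (suc zero)) = refl
swap₁₂-involutive (suc (suc (suc j))) = refl

swap₁₂-< : ∀ {n} j → 3 ≤ n → j < n → swap₁₂ j < n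
swap₁₂-< zero h lt = lt
swap₁₂-< (suc zero) h lt = h
swap₁₂-< (suc (suc zero)) h lt = NP.≤-trans (s≤s (s≤s z≤n)) h
swap₁₂-< (suc (suc (suc j))) h lt = lt

TwoEdgeSwitch : ∀ {n} → Graph n → EdgeSet n → Set
TwoEdgeSwitch {n} G C₀ = Σ (EdgeSet n) λ C₁ → IsHamCycle G C₁ × C₁ ≢ C₀ × newEdges C₁ C₀ ≡ 2

-- The switched tour visits s 0, s 2, s 1, s 3, s 4, …
crossedChords⇒switch : ∀ {n} {G : Graph n} {H₀ : EdgeSet n} (c : Tour G H₀) → 4 ≤ n →
  Adj G (Tour.s c 0) (Tour.s c 2) → Adj G (Tour.s c 1) (Tour.s c 3) → TwoEdgeSwitch G H₀
crossedChords⇒switch {zero} c ()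
crossedChords⇒switch {suc zero} c (s≤s ())
crossedChords⇒switch {suc (suc n0)} {G} {H₀} c h4 a02 a13 = C₁ , toIsHamCycle tour₁ , C₁≢H₀ , newEdges≡2
  where
  open TourProperties c
  n = suc (suc n0)
  φ : ℕ → Fin n
  φ j = s (swap₁₂ j)
  open PathEdges n0 φ renaming (K to C₁) hiding (n)
  h3 : 3 ≤ n
  h3 = n≥3
  lt0 : 0 < n
  lt0 = NP.≤-trans (s≤s z≤n) h4
  lt1 : 1 < n
  lt1 = NP.≤-trans (s≤s (s≤s z≤n)) h4
  lt2 : 2 < n
  lt2 = NP.≤-trans (s≤s (s≤s (s≤s z≤n))) h4
  lt3 : 3 < n
  lt3 = h4
  φinj : ∀ a b → a < n → b < n → φ a ≡ φ b → a ≡ b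
  φinj a b a< b< e = trans (sym (swap₁₂-involutive a)) (trans (cong swap₁₂ (inj _ _ (swap₁₂-< a h3 a<) (swap₁₂-< b h3 b<) e)) (swap₁₂-involutive b))
  φadj : ∀ j → suc j < n → Adj G (φ j) (φ (suc j))
  φadj zero _ = a02
  φadj (suc zero) _ = trans (symm G _ _) (adjacent 1)
  φadj (suc (suc zero)) _ = a13
  φadj (suc (suc (suc j))) _ = adjacent _
  s-wrap : ∀ j → suc j ≡ n → s (suc j) ≡ s 0
  s-wrap j eq = trans (cong s eq) (period 0)
  wrap≥3 : ∀ j → suc j ≡ n → 3 ≤ j
  wrap≥3 j eq = NP.≤-pred (subst (4 ≤_) (sym eq) h4)
  φwrap : ∀ j → suc j ≡ n → Adj G (φ j) (φ 0)
  φwrap (suc (suc (suc j))) eq = subst (Adj G (s (suc (suc (suc j))))) (s-wrap _ eq) (adjacent _)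
  φwrap zero eq with () ← wrap≥3 _ eq
  φwrap (suc zero) eq with wrap≥3 _ eq
  ... | s≤s ()
  φwrap (suc (suc zero)) eq with wrap≥3 _ eq
  ... | s≤s (s≤s ())
  tour₁ : Tour G C₁
  tour₁ = tourFromPath n0 G C₁ h3 φ φinj φadj φwrap edge⇒cyclicStep pathStep⇒edge closingStep⇒edge
  H-SameEdge : ∀ {x y p q} → SameEdge x y p q → H₀ ∋[ x , y ] ≡ true → H₀ ∋[ p , q ] ≡ true
  H-SameEdge (inj₁ (refl , refl)) h = h
  H-SameEdge (inj₂ (refl , refl)) h = H-sym h
  ¬H₀₂ : H₀ ∋[ s 0 , s 2 ] ≢ true
  ¬H₀₂ h with H-nbrs 0 (s 2) h
  ... | inj₁ e = s-distinct 2 1 lt2 lt1 (λ ()) e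
  ... | inj₂ e = absurd4 (subst (λ z → 4 ≤ suc z) (sym (inj 2 n' lt2 (NP.≤-reflexive suc-n'≡n) e)) (subst (4 ≤_) (sym suc-n'≡n) h4))
    where
    absurd4 : 4 ≤ 3 → ⊥
    absurd4 (s≤s (s≤s (s≤s ())))
  ¬H₁₃ : H₀ ∋[ s 1 , s 3 ] ≢ true
  ¬H₁₃ h with H-nbrs 1 (s 3) h
  ... | inj₁ e = s-distinct 3 2 lt3 lt2 (λ ()) e
  ... | inj₂ e = s-distinct 3 0 lt3 lt0 (λ ()) (trans e (trans (cong s (cong suc (NP.+-identityˡ n'))) (trans (cong s suc-n'≡n) (period 0))))
  C₁₀₂ : C₁ ∋[ s 0 , s 2 ] ≡ true
  C₁₀₂ = pathStep⇒edge _ _ 0 lt1 (inj₁ (refl , refl))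
  C₁≢H₀ : C₁ ≢ H₀
  C₁≢H₀ e = ¬H₀₂ (trans (cong (λ K → K ∋[ s 0 , s 2 ]) (sym e)) C₁₀₂)
  isNewᵇ : Fin n × Fin n → Bool
  isNewᵇ p = C₁ ∋[ proj₁ p , proj₂ p ] ∧ not (H₀ ∋[ proj₁ p , proj₂ p ])
  isNew⇒chord : ∀ x y → isNewᵇ (x , y) ≡ true → SameEdge x y (s 0) (s 2) ⊎ SameEdge x y (s 1) (s 3)
  isNew⇒chord x y h with ∧≡true⇒ {C₁ ∋[ x , y ]} h
  ... | hc , hn = go (edge⇒cyclicStep x y hc)
    where
    noH : ∀ k → SameEdge x y (s k) (s (suc k)) → ⊥
    noH k e with trans (sym (not≡true⇒≡false hn)) (step⇒edge x y k e)
    ... | ()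
    go : _ → SameEdge x y (s 0) (s 2) ⊎ SameEdge x y (s 1) (s 3)
    go (inj₁ (zero , _ , e)) = inj₁ e
    go (inj₁ (suc zero , _ , e)) = ⊥-elim (noH 1 (SameEdge-flip e))
    go (inj₁ (suc (suc zero) , _ , e)) = inj₂ e
    go (inj₁ (suc (suc (suc j)) , _ , e)) = ⊥-elim (noH _ e)
    go (inj₂ (j , eq , e)) with wrap≥3 j eq
    go (inj₂ (suc (suc (suc j)) , eq , e)) | _ = ⊥-elim (noH _ (SameEdge-cong refl (sym (s-wrap _ eq)) e))
    go (inj₂ (suc zero , eq , e)) | s≤s ()
    go (inj₂ (suc (suc zero) , eq , e)) | s≤s (s≤s ())
  chord⇒isNew : ∀ x y → SameEdge x y (s 0) (s 2) ⊎ SameEdge x y (s 1) (s 3) → isNewᵇ (x , y) ≡ true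
  chord⇒isNew x y (inj₁ e) rewrite pathStep⇒edge x y 0 lt1 e = ≡false⇒not≡true (≢true⇒≡false (λ h → ¬H₀₂ (H-SameEdge e h)))
  chord⇒isNew x y (inj₂ e) rewrite pathStep⇒edge x y 2 lt3 e = ≡false⇒not≡true (≢true⇒≡false (λ h → ¬H₁₃ (H-SameEdge e h)))
  newEdges≡2 : newEdges C₁ H₀ ≡ 2
  newEdges≡2 = countᴸ-pairs≡2 n isNewᵇ (s 0) (s 2) (s 1) (s 3) (s-distinct 0 2 lt0 lt2 (λ ())) (s-distinct 1 3 lt1 lt3 (λ ()))
           (λ { (inj₁ (e , _)) → s-distinct 0 1 lt0 lt1 (λ ()) e ; (inj₂ (e , _)) → s-distinct 2 1 lt2 lt1 (λ ()) e })
           isNew⇒chord chord⇒isNew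

-- Moving a triangle or a diamond to the front of a tour

OneOf3 : ∀ {n} → Fin n → Fin n → Fin n → Fin n → Set
OneOf3 u y z x = x ≡ u ⊎ x ≡ y ⊎ x ≡ z

TriangleFirst : ∀ {n} (G : Graph n) (H : EdgeSet n) → Fin n → Fin n → Fin n → Set
TriangleFirst G H u y z = Σ (Tour G H) λ c → OneOf3 u y z (Tour.s c 0) × OneOf3 u y z (Tour.s c 1) × OneOf3 u y z (Tour.s c 2)

TriangleFirst-swap : ∀ {n} {G : Graph n} {H} {u y z} → TriangleFirst G H u z y → TriangleFirst G H u y z
TriangleFirst-swap {n} {G} {H} {u} {y} {z} (c , t0 , t1 , t2) = c , sw t0 , sw t1 , sw t2
  where
  sw : ∀ {x} → OneOf3 u z y x → OneOf3 u y z x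
  sw (inj₁ e) = inj₁ e
  sw (inj₂ (inj₁ e)) = inj₂ (inj₂ e)
  sw (inj₂ (inj₂ e)) = inj₂ (inj₁ e)

module TriangleFirstCases {n} {G : Graph n} {H : EdgeSet n} (c : Tour G H) (h4 : 4 ≤ n)
  (u y z a ey ez : Fin n) (su : Tour.s c 1 ≡ u)
  (Ny : NbrsAmong G y u z ey) (Nz : NbrsAmong G z u y ez)
  (a≢z : a ≢ z) (ey≢z : ey ≢ z) (y≢z : y ≢ z) (u≢z : u ≢ z) where
  open TourProperties c
  lt0 : 0 < n
  lt0 = NP.≤-trans (s≤s z≤n) h4
  lt1 : 1 < n
  lt1 = NP.≤-trans (s≤s (s≤s z≤n)) h4
  lt3 : 3 < n
  lt3 = h4

  caseA : s 0 ≡ a → s 2 ≡ y → TriangleFirst G H u y z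
  caseA s0a s2y with Ny (s 3) (subst (λ w → Adj G w (s 3)) s2y (adjacent 2))
  ... | inj₁ e = ⊥-elim (s-distinct 3 1 lt3 lt1 (λ ()) (trans e (sym su)))
  ... | inj₂ (inj₁ e) = rotate 1 , inj₁ su , inj₂ (inj₁ s2y) , inj₂ (inj₂ e)
  ... | inj₂ (inj₂ e) = ⊥-elim (H-misses-two z u y ez Nz
          (subst (λ w → H ∋[ z , w ] ≢ true) su (¬H-suc 0 z (λ e' → y≢z (trans (sym s2y) (sym e'))) (λ e' → a≢z (trans (sym s0a) (sym e')))))
          (subst (λ w → H ∋[ z , w ] ≢ true) s2y (¬H-suc 1 z (λ e' → ey≢z (trans (sym e) (sym e'))) (λ e' → u≢z (trans (sym su) (sym e'))))))

  caseB : s 0 ≡ y → s 2 ≡ a → TriangleFirst G H u y z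
  caseB s0y s2a with Ny (s (prev 0)) (Adj-sym {G = G} (subst (Adj G (s (prev 0))) (trans (s-suc-prev 0) s0y) (adjacent (prev 0))))
  ... | inj₁ e = ⊥-elim (absurd (inj n' 1 (NP.≤-reflexive suc-n'≡n) lt1 (trans e (sym su))))
    where
    absurd : n' ≢ 1
    absurd e' with subst (4 ≤_) (trans (sym suc-n'≡n) (cong suc e')) h4
    ... | s≤s (s≤s ())
  ... | inj₂ (inj₁ e) = rotate n' , inj₂ (inj₂ e) , inj₂ (inj₁ (trans (s-suc-prev 0) s0y)) , inj₁ (trans (s-suc-prev 1) su)
  ... | inj₂ (inj₂ e) = ⊥-elim (H-misses-two z u y ez Nz
          (subst (λ w → H ∋[ z , w ] ≢ true) su (¬H-suc 0 z (λ e' → a≢z (trans (sym s2a) (sym e'))) (λ e' → y≢z (trans (sym s0y) (sym e')))))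
          (subst (λ w → H ∋[ z , w ] ≢ true) s0y nH0))
    where
    nH0 : H ∋[ z , s 0 ] ≢ true
    nH0 h with H-nbrs 0 z (H-sym h)
    ... | inj₁ e' = u≢z (trans (sym su) (sym e'))
    ... | inj₂ e' = ey≢z (trans (sym e) (sym e'))

triangleFirst : ∀ {n} {G : Graph n} {H : EdgeSet n} (c : Tour G H) (h4 : 4 ≤ n)
  (u y z a ey ez : Fin n)
  (Nu : NbrsAmong G u y z a) (Ny : NbrsAmong G y u z ey) (Nz : NbrsAmong G z u y ez)
  (a≢y : a ≢ y) (a≢z : a ≢ z) (ey≢z : ey ≢ z) (ez≢y : ez ≢ y) (y≢z : y ≢ z) (u≢y : u ≢ y) (u≢z : u ≢ z) →
  TriangleFirst G H u y z
triangleFirst {n} {G} {H} c h4 u y z a ey ez Nu Ny Nz a≢y a≢z ey≢z ez≢y y≢z u≢y u≢z with TourProperties.s-surjective c u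
... | k , _ , sk = go (Nu (s 0) (Adj-sym {G = G} (subst (Adj G (s 0)) su (adjacent 0)))) (Nu (s 2) (subst (λ w → Adj G w (s 2)) su (adjacent 1)))
  where
  c1 = TourProperties.rotate c (k + TourProperties.n' c)
  open Tour c1
  su : s 1 ≡ u
  su = trans (TourProperties.s-suc-prev c k) sk
  ne02 : s 0 ≢ s 2
  ne02 = TourProperties.s-distinct c1 0 2 (NP.≤-trans (s≤s z≤n) h4) (NP.≤-trans (s≤s (s≤s (s≤s z≤n))) h4) (λ ())
  module A = TriangleFirstCases c1 h4 u y z a ey ez su Ny Nz a≢z ey≢z y≢z u≢z
  module B = TriangleFirstCases c1 h4 u z y a ez ey su Nz Ny a≢y ez≢y (λ e → y≢z (sym e)) u≢y
  go : OneOf3 y z a (s 0) → OneOf3 y z a (s 2) → TriangleFirst G H u y z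
  go (inj₁ e0) (inj₁ e2) = ⊥-elim (ne02 (trans e0 (sym e2)))
  go (inj₂ (inj₁ e0)) (inj₂ (inj₁ e2)) = ⊥-elim (ne02 (trans e0 (sym e2)))
  go (inj₂ (inj₂ e0)) (inj₂ (inj₂ e2)) = ⊥-elim (ne02 (trans e0 (sym e2)))
  go (inj₁ e0) (inj₂ (inj₁ e2)) = c1 , inj₂ (inj₁ e0) , inj₁ su , inj₂ (inj₂ e2)
  go (inj₂ (inj₁ e0)) (inj₁ e2) = c1 , inj₂ (inj₂ e0) , inj₁ su , inj₂ (inj₁ e2)
  go (inj₂ (inj₂ e0)) (inj₁ e2) = A.caseA e0 e2
  go (inj₂ (inj₂ e0)) (inj₂ (inj₁ e2)) = TriangleFirst-swap {G = G} {H} {u} {y} {z} (B.caseA e0 e2)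
  go (inj₁ e0) (inj₂ (inj₂ e2)) = A.caseB e0 e2
  go (inj₂ (inj₁ e0)) (inj₂ (inj₂ e2)) = TriangleFirst-swap {G = G} {H} {u} {y} {z} (B.caseB e0 e2)

CrossedChords : ∀ {n} (G : Graph n) (H : EdgeSet n) → Set
CrossedChords G H = Σ (Tour G H) λ c → Adj G (Tour.s c 0) (Tour.s c 2) × Adj G (Tour.s c 1) (Tour.s c 3)

decElim : ∀ {A B : Set} → Dec A → (A → B) → (¬ A → B) → B
decElim (yes a) f g = f a
decElim (no na) f g = g na

Adj-cong : ∀ {n} {G : Graph n} {x y x' y'} → x' ≡ x → y' ≡ y → Adj G x y → Adj G x' y'
Adj-cong refl refl h' = h'

NbrsAmong-cong : ∀ {n} {G : Graph n} {x α β γ α' β' γ'} → α ≡ α' → β ≡ β' → γ ≡ γ' → NbrsAmong G x α β γ → NbrsAmong G x α' β' γ'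
NbrsAmong-cong refl refl refl h = h

-- p q r d span K₄ minus the edge rd, and e is the third neighbour of r.
diamond⇒CrossedChords : ∀ {n} {G : Graph n} {H : EdgeSet n} (c : Tour G H) (h4 : 4 ≤ n)
  (p q r d e : Fin n) (pq : Adj G p q) (pr : Adj G p r) (pd : Adj G p d) (qr : Adj G q r) (qd : Adj G q d) (re : Adj G r e)
  (Np : NbrsAmong G p q r d) (Nq : NbrsAmong G q p r d)
  (p≢q : p ≢ q) (q≢r : q ≢ r) (d≢q : d ≢ q) (e≢p : e ≢ p) (e≢q : e ≢ q) (e≢r : e ≢ r) →
  CrossedChords G H
diamond⇒CrossedChords {n} {G} {H} c h4 p q r d e pq pr pd qr qd re Np Nq p≢q q≢r d≢q e≢p e≢q e≢r with TourProperties.s-surjective c p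
... | k , _ , sk = go (Np (s 0) (Adj-sym {G = G} (subst (Adj G (s 0)) su (adjacent 0)))) (Np (s 2) (subst (λ w → Adj G w (s 2)) su (adjacent 1)))
  where
  c1 = TourProperties.rotate c (k + TourProperties.n' c)
  open TourProperties c1
  su : s 1 ≡ p
  su = trans (TourProperties.s-suc-prev c k) sk
  lt0 : 0 < n
  lt0 = NP.≤-trans (s≤s z≤n) h4
  lt1 : 1 < n
  lt1 = NP.≤-trans (s≤s (s≤s z≤n)) h4
  lt2 : 2 < n
  lt2 = NP.≤-trans (s≤s (s≤s (s≤s z≤n))) h4
  lt3 : 3 < n
  lt3 = h4
  ne02 : s 0 ≢ s 2
  ne02 = s-distinct 0 2 lt0 lt2 (λ ())
  adjp : ∀ x → x ≡ r ⊎ x ≡ d → Adj G p x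
  adjp x (inj₁ refl) = pr
  adjp x (inj₂ refl) = pd
  adjq : ∀ x → x ≡ r ⊎ x ≡ d → Adj G x q
  adjq x (inj₁ refl) = Adj-sym {G = G} qr
  adjq x (inj₂ refl) = Adj-sym {G = G} qd
  s3p : s 3 ≢ p
  s3p e' = s-distinct 3 1 lt3 lt1 (λ ()) (trans e' (sym su))
  pre0p : s (prev 0) ≢ p
  pre0p e' with subst (4 ≤_) (trans (sym suc-n'≡n) (cong suc (inj n' 1 (NP.≤-reflexive suc-n'≡n) lt1 (trans e' (sym su))))) h4
  ... | s≤s (s≤s ())
  otherRD : ∀ x → x ≢ p → x ≡ p ⊎ x ≡ r ⊎ x ≡ d → x ≡ r ⊎ x ≡ d
  otherRD x ne (inj₁ e') = ⊥-elim (ne e')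
  otherRD x ne (inj₂ h) = h
  caseQ2 : s 2 ≡ q → s 0 ≡ r ⊎ s 0 ≡ d → CrossedChords G H
  caseQ2 s2q s0rd = c1 , subst (Adj G (s 0)) (sym s2q) (adjq _ s0rd) ,
     subst (λ w → Adj G w (s 3)) (sym su) (adjp _ (otherRD _ s3p (Nq (s 3) (subst (λ w → Adj G w (s 3)) s2q (adjacent 2)))))
  caseQ0 : s 0 ≡ q → s 2 ≡ r ⊎ s 2 ≡ d → CrossedChords G H
  caseQ0 s0q s2rd = rotate n' , Adj-cong {G = G} refl (trans (s-suc-prev 1) su) (Adj-sym {G = G} (adjp _ Prd)) ,
     Adj-cong {G = G} (trans (s-suc-prev 0) s0q) (s-suc-prev 2) (Adj-sym {G = G} (adjq _ s2rd))
    where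
    Prd : s (prev 0) ≡ r ⊎ s (prev 0) ≡ d
    Prd = otherRD _ pre0p (Nq (s (prev 0)) (Adj-sym {G = G} (subst (Adj G (s (prev 0))) (trans (s-suc-prev 0) s0q) (adjacent (prev 0)))))
  caseRD : (s 0 ≡ r × s 2 ≡ d) ⊎ (s 0 ≡ d × s 2 ≡ r) → CrossedChords G H
  caseRD h = fin (e F.≟ d)
    where
    s0rd : s 0 ≡ r ⊎ s 0 ≡ d
    s0rd = Data.Sum.map proj₁ proj₁ h
    Nq1 : NbrsAmong G q p (s 2) (s 0)
    Nq1 = f h
      where
      f : (s 0 ≡ r × s 2 ≡ d) ⊎ (s 0 ≡ d × s 2 ≡ r) → NbrsAmong G q p (s 2) (s 0)
      f (inj₁ (a1 , a2)) = NbrsAmong-cong {G = G} refl (sym a2) (sym a1) (NbrsAmong-swap₂₃ {G = G} Nq)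
      f (inj₂ (a1 , a2)) = NbrsAmong-cong {G = G} refl (sym a2) (sym a1) Nq
    nq0 : q ≢ s 0
    nq0 e' = f h
      where
      f : (s 0 ≡ r × s 2 ≡ d) ⊎ (s 0 ≡ d × s 2 ≡ r) → ⊥
      f (inj₁ (a1 , _)) = q≢r (trans e' a1)
      f (inj₂ (a1 , _)) = d≢q (sym (trans e' a1))
    nq2 : q ≢ s 2
    nq2 e' = f h
      where
      f : (s 0 ≡ r × s 2 ≡ d) ⊎ (s 0 ≡ d × s 2 ≡ r) → ⊥
      f (inj₁ (_ , a2)) = d≢q (sym (trans e' a2))
      f (inj₂ (_ , a2)) = q≢r (trans e' a2)
    nqp : q ≢ s 1
    nqp e' = p≢q (sym (trans e' su))
    nHqp : H ∋[ q , s 1 ] ≢ true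
    nHqp = ¬H-suc 0 q nq2 nq0
    s3q : s 3 ≡ q
    s3q = decElim (q F.≟ s 3) sym (λ ne → ⊥-elim (H-misses-two q (s 1) (s 2) (s 0) (NbrsAmong-cong {G = G} (sym su) refl refl Nq1) nHqp (¬H-suc 1 q ne nqp)))
    preq : s (prev 0) ≡ q
    preq = decElim (q F.≟ s (prev 0)) sym (λ ne → ⊥-elim (H-misses-two q (s 1) (s 0) (s 2) (NbrsAmong-cong {G = G} (sym su) refl refl (NbrsAmong-swap₂₃ {G = G} Nq1)) nHqp
             (λ hh → Data.Sum.[ nqp , ne ] (H-nbrs 0 q (H-sym hh)))))
    fin : Dec (e ≡ d) → CrossedChords G H
    fin (yes refl) = c1 , a02 , subst (λ w → Adj G w (s 3)) (sym su) (subst (Adj G p) (sym s3q) pq)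
      where
      a02 : Adj G (s 0) (s 2)
      a02 = f h
        where
        f : (s 0 ≡ r × s 2 ≡ e) ⊎ (s 0 ≡ e × s 2 ≡ r) → Adj G (s 0) (s 2)
        f (inj₁ (a1 , a2)) = Adj-cong {G = G} a1 a2 re
        f (inj₂ (a1 , a2)) = Adj-cong {G = G} a1 a2 (Adj-sym {G = G} re)
    fin (no e≢d) = ⊥-elim (n4 (n≤4 (NP.<-cmp 4 n)))
      where
      s04 : s 0 ≡ s 4
      s04 = trans (sym (s-suc-prev 0)) (s-suc-cong {prev 0} {3} (trans preq (sym s3q)))
      n≤4 : Tri (4 < n) (4 ≡ n) (n < 4) → n ≤ 4
      n≤4 (tri< lt _ _) = ⊥-elim (s-distinct 0 4 lt0 lt (λ ()) s04)
      n≤4 (tri≈ _ eq _) = NP.≤-reflexive (sym eq)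
      n≤4 (tri> _ _ gt) = NP.<⇒≤ gt
      n4 : n ≤ 4 → ⊥
      n4 le with s-surjective e
      ... | j , j< , sj = pick j (NP.≤-trans j< le) sj
        where
        erd : ∀ {x} → x ≡ r ⊎ x ≡ d → e ≢ x
        erd (inj₁ a) e' = e≢r (trans e' a)
        erd (inj₂ a) e' = e≢d (trans e' a)
        s2rd : s 2 ≡ r ⊎ s 2 ≡ d
        s2rd = Data.Sum.map proj₂ proj₂ (Data.Sum.swap h)
        pick : ∀ j → j < 4 → s j ≡ e → ⊥
        pick zero _ sj = erd s0rd (sym sj)
        pick (suc zero) _ sj = e≢p (trans (sym sj) su)
        pick (suc (suc zero)) _ sj = erd s2rd (sym sj)
        pick (suc (suc (suc zero))) _ sj = e≢q (trans (sym sj) s3q)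
        pick (suc (suc (suc (suc j)))) (s≤s (s≤s (s≤s (s≤s ())))) sj
  go : OneOf3 q r d (s 0) → OneOf3 q r d (s 2) → CrossedChords G H
  go (inj₁ e0) (inj₁ e2) = ⊥-elim (ne02 (trans e0 (sym e2)))
  go (inj₂ (inj₁ e0)) (inj₂ (inj₁ e2)) = ⊥-elim (ne02 (trans e0 (sym e2)))
  go (inj₂ (inj₂ e0)) (inj₂ (inj₂ e2)) = ⊥-elim (ne02 (trans e0 (sym e2)))
  go e0 (inj₁ e2) = caseQ2 e2 (f e0)
    where
    f : OneOf3 q r d (s 0) → s 0 ≡ r ⊎ s 0 ≡ d
    f (inj₁ e0) = ⊥-elim (ne02 (trans e0 (sym e2)))
    f (inj₂ h) = h
  go (inj₁ e0) (inj₂ e2) = caseQ0 e0 e2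
  go (inj₂ (inj₁ e0)) (inj₂ (inj₂ e2)) = caseRD (inj₁ (e0 , e2))
  go (inj₂ (inj₂ e0)) (inj₂ (inj₁ e2)) = caseRD (inj₂ (e0 , e2))

-- Contracting a triangle

Pendant : ∀ {n} → Fin n → Fin n → Fin n → Fin n → Fin n → Fin n → Fin n → Fin n → Set
Pendant u v w a b c r x = (r ≡ u × x ≡ a) ⊎ (r ≡ v × x ≡ c) ⊎ (r ≡ w × x ≡ b)

CubicReduction : ∀ {n} → Graph n → Set
CubicReduction {n} G = Σ (Graph (n ∸ 2)) λ G' → Cubic G' × Hamiltonian G' × HamBijection G G'

module Contraction (m0 : ℕ) (G : Graph (suc (suc (suc (suc m0))))) (cub : Cubic G)
  (u v w : Fin (suc (suc (suc (suc m0))))) (uv : Adj G u v) (vw : Adj G v w) (wu : Adj G w u)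
  (U : ThirdNbr G u v w) (V : ThirdNbr G v u w) (W : ThirdNbr G w u v)
  (a≢b : ThirdNbr.nbr U ≢ ThirdNbr.nbr W) (a≢c : ThirdNbr.nbr U ≢ ThirdNbr.nbr V)
  (b≢c : ThirdNbr.nbr W ≢ ThirdNbr.nbr V) (m0≥1 : 1 ≤ m0) where

  open ThirdNbr U using () renaming (nbr to a; x~nbr to ua; nbr≢y to a≢v; nbr≢z to a≢w; nbrs to Nu)
  open ThirdNbr V using () renaming (nbr to c; x~nbr to vc; nbr≢y to c≢u; nbr≢z to c≢w; nbrs to Nv)
  open ThirdNbr W using () renaming (nbr to b; x~nbr to wb; nbr≢y to b≢u; nbr≢z to b≢v; nbrs to Nw)

  n = suc (suc (suc (suc m0)))
  m = suc (suc m0)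

  u≢v : u ≢ v
  u≢v = Adj⇒≢ {G = G} uv
  v≢w : v ≢ w
  v≢w = Adj⇒≢ {G = G} vw
  w≢u : w ≢ u
  w≢u = Adj⇒≢ {G = G} wu
  a≢u : a ≢ u
  a≢u e' = Adj⇒≢ {G = G} ua (sym e')
  c≢v : c ≢ v
  c≢v e' = Adj⇒≢ {G = G} vc (sym e')
  b≢w : b ≢ w
  b≢w e' = Adj⇒≢ {G = G} wb (sym e')

  InT : Fin n → Set
  InT = OneOf3 u v w

  OutT : Fin n → Set
  OutT x = x ≢ u × x ≢ v × x ≢ w

  w' : Fin (suc m)
  w' = punchOut v≢w

  e : Fin m → Fin n
  e j = punchIn v (punchIn w' j)

  e≢v : ∀ j → e j ≢ v
  e≢v j = FP.punchInᵢ≢i v _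

  e≢w : ∀ j → e j ≢ w
  e≢w j h = FP.punchInᵢ≢i w' j (FP.punchIn-injective v _ _ (trans h (sym (FP.punchIn-punchOut v≢w))))

  e-inj : ∀ {i j} → e i ≡ e j → i ≡ j
  e-inj h = FP.punchIn-injective w' _ _ (FP.punchIn-injective v _ _ h)

  -- G' lives on Fin m, embedded into Fin n by e, which skips v and w.  The
  -- contracted vertex t is the preimage of u, and π sends v and w to t as well.
  π₀ : Fin n → Fin m → Fin m
  π₀ x d with v F.≟ x
  ... | yes _ = d
  ... | no ne with w' F.≟ punchOut ne
  ...   | yes _ = d
  ...   | no ne' = punchOut ne'

  eπ₀ : ∀ x d → x ≢ v → x ≢ w → e (π₀ x d) ≡ x
  eπ₀ x d xv xw with v F.≟ x
  ... | yes e' = ⊥-elim (xv (sym e'))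
  ... | no ne with w' F.≟ punchOut ne
  ...   | yes e' = ⊥-elim (xw (trans (sym (FP.punchIn-punchOut ne)) (trans (cong (punchIn v) (sym e')) (FP.punchIn-punchOut v≢w))))
  ...   | no ne' = trans (cong (punchIn v) (FP.punchIn-punchOut ne')) (FP.punchIn-punchOut ne)

  t : Fin m
  t = π₀ u fz

  π : Fin n → Fin m
  π x = π₀ x t

  eπ : ∀ x → x ≢ v → x ≢ w → e (π x) ≡ x
  eπ x = eπ₀ x t

  πe : ∀ j → π (e j) ≡ j
  πe j = e-inj (eπ (e j) (e≢v j) (e≢w j))

  et : e t ≡ u
  et = eπ₀ u fz u≢v (λ h → w≢u (sym h))

  πu : π u ≡ t
  πu = e-inj (trans (eπ u (λ h → u≢v h) (λ h → w≢u (sym h))) (sym et))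

  eNT : ∀ y → y ≢ t → OutT (e y)
  eNT y ne = (λ h → ne (trans (sym (πe y)) (trans (cong π h) πu))) , e≢v y , e≢w y

  πNT : ∀ x → OutT x → π x ≢ t
  πNT x (xu , xv , xw) h = xu (trans (sym (eπ x xv xw)) (trans (cong e h) et))

  eπNT : ∀ x → OutT x → e (π x) ≡ x
  eπNT x (_ , xv , xw) = eπ x xv xw

  pendantOf : ∀ x r → OutT x → InT r → Adj G x r → Pendant u v w a b c r x
  pendantOf x r (xu , xv , xw) (inj₁ refl) h with Nu x (Adj-sym {G = G} h)
  ... | inj₁ e' = ⊥-elim (xv e')
  ... | inj₂ (inj₁ e') = ⊥-elim (xw e')
  ... | inj₂ (inj₂ e') = inj₁ (refl , e')
  pendantOf x r (xu , xv , xw) (inj₂ (inj₁ refl)) h with Nv x (Adj-sym {G = G} h)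
  ... | inj₁ e' = ⊥-elim (xu e')
  ... | inj₂ (inj₁ e') = ⊥-elim (xw e')
  ... | inj₂ (inj₂ e') = inj₂ (inj₁ (refl , e'))
  pendantOf x r (xu , xv , xw) (inj₂ (inj₂ refl)) h with Nw x (Adj-sym {G = G} h)
  ... | inj₁ e' = ⊥-elim (xu e')
  ... | inj₂ (inj₁ e') = ⊥-elim (xv e')
  ... | inj₂ (inj₂ e') = inj₂ (inj₂ (refl , e'))

  Pendant-base-unique : ∀ {r r' x} → Pendant u v w a b c r x → Pendant u v w a b c r' x → r ≡ r'
  Pendant-base-unique (inj₁ (refl , refl)) (inj₁ (refl , _)) = refl
  Pendant-base-unique (inj₁ (refl , refl)) (inj₂ (inj₁ (_ , e'))) = ⊥-elim (a≢c e')
  Pendant-base-unique (inj₁ (refl , refl)) (inj₂ (inj₂ (_ , e'))) = ⊥-elim (a≢b e')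
  Pendant-base-unique (inj₂ (inj₁ (refl , refl))) (inj₁ (_ , e')) = ⊥-elim (a≢c (sym e'))
  Pendant-base-unique (inj₂ (inj₁ (refl , refl))) (inj₂ (inj₁ (refl , _))) = refl
  Pendant-base-unique (inj₂ (inj₁ (refl , refl))) (inj₂ (inj₂ (_ , e'))) = ⊥-elim (b≢c (sym e'))
  Pendant-base-unique (inj₂ (inj₂ (refl , refl))) (inj₁ (_ , e')) = ⊥-elim (a≢b (sym e'))
  Pendant-base-unique (inj₂ (inj₂ (refl , refl))) (inj₂ (inj₁ (_ , e'))) = ⊥-elim (b≢c e')
  Pendant-base-unique (inj₂ (inj₂ (refl , refl))) (inj₂ (inj₂ (refl , _))) = refl

  Pendant-unique : ∀ {r x x'} → Pendant u v w a b c r x → Pendant u v w a b c r x' → x ≡ x'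
  Pendant-unique (inj₁ (refl , refl)) (inj₁ (_ , refl)) = refl
  Pendant-unique (inj₁ (refl , refl)) (inj₂ (inj₁ (e' , _))) = ⊥-elim (u≢v e')
  Pendant-unique (inj₁ (refl , refl)) (inj₂ (inj₂ (e' , _))) = ⊥-elim (w≢u (sym e'))
  Pendant-unique (inj₂ (inj₁ (refl , refl))) (inj₁ (e' , _)) = ⊥-elim (u≢v (sym e'))
  Pendant-unique (inj₂ (inj₁ (refl , refl))) (inj₂ (inj₁ (_ , refl))) = refl
  Pendant-unique (inj₂ (inj₁ (refl , refl))) (inj₂ (inj₂ (e' , _))) = ⊥-elim (v≢w e')
  Pendant-unique (inj₂ (inj₂ (refl , refl))) (inj₁ (e' , _)) = ⊥-elim (w≢u e')
  Pendant-unique (inj₂ (inj₂ (refl , refl))) (inj₂ (inj₁ (e' , _))) = ⊥-elim (v≢w (sym e'))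
  Pendant-unique (inj₂ (inj₂ (refl , refl))) (inj₂ (inj₂ (_ , refl))) = refl

  Pendant-OutT : ∀ {r x} → Pendant u v w a b c r x → OutT x
  Pendant-OutT (inj₁ (_ , refl)) = a≢u , a≢v , a≢w
  Pendant-OutT (inj₂ (inj₁ (_ , refl))) = c≢u , c≢v , c≢w
  Pendant-OutT (inj₂ (inj₂ (_ , refl))) = b≢u , b≢v , b≢w

  pendantAt : ∀ r → InT r → ∃ λ x → Pendant u v w a b c r x
  pendantAt r (inj₁ refl) = a , inj₁ (refl , refl)
  pendantAt r (inj₂ (inj₁ refl)) = c , inj₂ (inj₁ (refl , refl))
  pendantAt r (inj₂ (inj₂ refl)) = b , inj₂ (inj₂ (refl , refl))

  InT-Adj : ∀ {r r'} → InT r → InT r' → r ≢ r' → Adj G r r'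
  InT-Adj (inj₁ refl) (inj₁ refl) ne = ⊥-elim (ne refl)
  InT-Adj (inj₁ refl) (inj₂ (inj₁ refl)) ne = uv
  InT-Adj (inj₁ refl) (inj₂ (inj₂ refl)) ne = Adj-sym {G = G} wu
  InT-Adj (inj₂ (inj₁ refl)) (inj₁ refl) ne = Adj-sym {G = G} uv
  InT-Adj (inj₂ (inj₁ refl)) (inj₂ (inj₁ refl)) ne = ⊥-elim (ne refl)
  InT-Adj (inj₂ (inj₁ refl)) (inj₂ (inj₂ refl)) ne = vw
  InT-Adj (inj₂ (inj₂ refl)) (inj₁ refl) ne = wu
  InT-Adj (inj₂ (inj₂ refl)) (inj₂ (inj₁ refl)) ne = Adj-sym {G = G} vw
  InT-Adj (inj₂ (inj₂ refl)) (inj₂ (inj₂ refl)) ne = ⊥-elim (ne refl)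

  InT-cover : ∀ {x0 x1 x2} → InT x0 → InT x1 → InT x2 → x0 ≢ x1 → x0 ≢ x2 → x1 ≢ x2 → ∀ r → InT r → r ≡ x0 ⊎ r ≡ x1 ⊎ r ≡ x2
  InT-cover (inj₁ refl) (inj₁ refl) (inj₁ refl) n01 n02 n12 r tr = ⊥-elim (n01 refl)
  InT-cover (inj₁ refl) (inj₁ refl) (inj₂ (inj₁ refl)) n01 n02 n12 r tr = ⊥-elim (n01 refl)
  InT-cover (inj₁ refl) (inj₁ refl) (inj₂ (inj₂ refl)) n01 n02 n12 r tr = ⊥-elim (n01 refl)
  InT-cover (inj₁ refl) (inj₂ (inj₁ refl)) (inj₁ refl) n01 n02 n12 r tr = ⊥-elim (n02 refl)
  InT-cover (inj₁ refl) (inj₂ (inj₁ refl)) (inj₂ (inj₁ refl)) n01 n02 n12 r tr = ⊥-elim (n12 refl)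
  InT-cover (inj₁ refl) (inj₂ (inj₁ refl)) (inj₂ (inj₂ refl)) n01 n02 n12 r (inj₁ refl) = inj₁ refl
  InT-cover (inj₁ refl) (inj₂ (inj₁ refl)) (inj₂ (inj₂ refl)) n01 n02 n12 r (inj₂ (inj₁ refl)) = inj₂ (inj₁ refl)
  InT-cover (inj₁ refl) (inj₂ (inj₁ refl)) (inj₂ (inj₂ refl)) n01 n02 n12 r (inj₂ (inj₂ refl)) = inj₂ (inj₂ refl)
  InT-cover (inj₁ refl) (inj₂ (inj₂ refl)) (inj₁ refl) n01 n02 n12 r tr = ⊥-elim (n02 refl)
  InT-cover (inj₁ refl) (inj₂ (inj₂ refl)) (inj₂ (inj₁ refl)) n01 n02 n12 r (inj₁ refl) = inj₁ refl
  InT-cover (inj₁ refl) (inj₂ (inj₂ refl)) (inj₂ (inj₁ refl)) n01 n02 n12 r (inj₂ (inj₁ refl)) = inj₂ (inj₂ refl)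
  InT-cover (inj₁ refl) (inj₂ (inj₂ refl)) (inj₂ (inj₁ refl)) n01 n02 n12 r (inj₂ (inj₂ refl)) = inj₂ (inj₁ refl)
  InT-cover (inj₁ refl) (inj₂ (inj₂ refl)) (inj₂ (inj₂ refl)) n01 n02 n12 r tr = ⊥-elim (n12 refl)
  InT-cover (inj₂ (inj₁ refl)) (inj₁ refl) (inj₁ refl) n01 n02 n12 r tr = ⊥-elim (n12 refl)
  InT-cover (inj₂ (inj₁ refl)) (inj₁ refl) (inj₂ (inj₁ refl)) n01 n02 n12 r tr = ⊥-elim (n02 refl)
  InT-cover (inj₂ (inj₁ refl)) (inj₁ refl) (inj₂ (inj₂ refl)) n01 n02 n12 r (inj₁ refl) = inj₂ (inj₁ refl)
  InT-cover (inj₂ (inj₁ refl)) (inj₁ refl) (inj₂ (inj₂ refl)) n01 n02 n12 r (inj₂ (inj₁ refl)) = inj₁ refl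
  InT-cover (inj₂ (inj₁ refl)) (inj₁ refl) (inj₂ (inj₂ refl)) n01 n02 n12 r (inj₂ (inj₂ refl)) = inj₂ (inj₂ refl)
  InT-cover (inj₂ (inj₁ refl)) (inj₂ (inj₁ refl)) (inj₁ refl) n01 n02 n12 r tr = ⊥-elim (n01 refl)
  InT-cover (inj₂ (inj₁ refl)) (inj₂ (inj₁ refl)) (inj₂ (inj₁ refl)) n01 n02 n12 r tr = ⊥-elim (n01 refl)
  InT-cover (inj₂ (inj₁ refl)) (inj₂ (inj₁ refl)) (inj₂ (inj₂ refl)) n01 n02 n12 r tr = ⊥-elim (n01 refl)
  InT-cover (inj₂ (inj₁ refl)) (inj₂ (inj₂ refl)) (inj₁ refl) n01 n02 n12 r (inj₁ refl) = inj₂ (inj₂ refl)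
  InT-cover (inj₂ (inj₁ refl)) (inj₂ (inj₂ refl)) (inj₁ refl) n01 n02 n12 r (inj₂ (inj₁ refl)) = inj₁ refl
  InT-cover (inj₂ (inj₁ refl)) (inj₂ (inj₂ refl)) (inj₁ refl) n01 n02 n12 r (inj₂ (inj₂ refl)) = inj₂ (inj₁ refl)
  InT-cover (inj₂ (inj₁ refl)) (inj₂ (inj₂ refl)) (inj₂ (inj₁ refl)) n01 n02 n12 r tr = ⊥-elim (n02 refl)
  InT-cover (inj₂ (inj₁ refl)) (inj₂ (inj₂ refl)) (inj₂ (inj₂ refl)) n01 n02 n12 r tr = ⊥-elim (n12 refl)
  InT-cover (inj₂ (inj₂ refl)) (inj₁ refl) (inj₁ refl) n01 n02 n12 r tr = ⊥-elim (n12 refl)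
  InT-cover (inj₂ (inj₂ refl)) (inj₁ refl) (inj₂ (inj₁ refl)) n01 n02 n12 r (inj₁ refl) = inj₂ (inj₁ refl)
  InT-cover (inj₂ (inj₂ refl)) (inj₁ refl) (inj₂ (inj₁ refl)) n01 n02 n12 r (inj₂ (inj₁ refl)) = inj₂ (inj₂ refl)
  InT-cover (inj₂ (inj₂ refl)) (inj₁ refl) (inj₂ (inj₁ refl)) n01 n02 n12 r (inj₂ (inj₂ refl)) = inj₁ refl
  InT-cover (inj₂ (inj₂ refl)) (inj₁ refl) (inj₂ (inj₂ refl)) n01 n02 n12 r tr = ⊥-elim (n02 refl)
  InT-cover (inj₂ (inj₂ refl)) (inj₂ (inj₁ refl)) (inj₁ refl) n01 n02 n12 r (inj₁ refl) = inj₂ (inj₂ refl)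
  InT-cover (inj₂ (inj₂ refl)) (inj₂ (inj₁ refl)) (inj₁ refl) n01 n02 n12 r (inj₂ (inj₁ refl)) = inj₂ (inj₁ refl)
  InT-cover (inj₂ (inj₂ refl)) (inj₂ (inj₁ refl)) (inj₁ refl) n01 n02 n12 r (inj₂ (inj₂ refl)) = inj₁ refl
  InT-cover (inj₂ (inj₂ refl)) (inj₂ (inj₁ refl)) (inj₂ (inj₁ refl)) n01 n02 n12 r tr = ⊥-elim (n12 refl)
  InT-cover (inj₂ (inj₂ refl)) (inj₂ (inj₁ refl)) (inj₂ (inj₂ refl)) n01 n02 n12 r tr = ⊥-elim (n02 refl)
  InT-cover (inj₂ (inj₂ refl)) (inj₂ (inj₂ refl)) (inj₁ refl) n01 n02 n12 r tr = ⊥-elim (n01 refl)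
  InT-cover (inj₂ (inj₂ refl)) (inj₂ (inj₂ refl)) (inj₂ (inj₁ refl)) n01 n02 n12 r tr = ⊥-elim (n01 refl)
  InT-cover (inj₂ (inj₂ refl)) (inj₂ (inj₂ refl)) (inj₂ (inj₂ refl)) n01 n02 n12 r tr = ⊥-elim (n01 refl)

  InT-third : ∀ {x y} → InT x → InT y → x ≢ y → ∃ λ z → InT z × z ≢ x × z ≢ y
  InT-third (inj₁ refl) (inj₁ refl) ne = ⊥-elim (ne refl)
  InT-third (inj₁ refl) (inj₂ (inj₁ refl)) ne = w , inj₂ (inj₂ refl) , w≢u , (λ h → v≢w (sym h))
  InT-third (inj₁ refl) (inj₂ (inj₂ refl)) ne = v , inj₂ (inj₁ refl) , (λ h → u≢v (sym h)) , v≢w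
  InT-third (inj₂ (inj₁ refl)) (inj₁ refl) ne = w , inj₂ (inj₂ refl) , (λ h → v≢w (sym h)) , w≢u
  InT-third (inj₂ (inj₁ refl)) (inj₂ (inj₁ refl)) ne = ⊥-elim (ne refl)
  InT-third (inj₂ (inj₁ refl)) (inj₂ (inj₂ refl)) ne = u , inj₁ refl , u≢v , (λ h → w≢u (sym h))
  InT-third (inj₂ (inj₂ refl)) (inj₁ refl) ne = v , inj₂ (inj₁ refl) , v≢w , (λ h → u≢v (sym h))
  InT-third (inj₂ (inj₂ refl)) (inj₂ (inj₁ refl)) ne = u , inj₁ refl , (λ h → w≢u (sym h)) , u≢v
  InT-third (inj₂ (inj₂ refl)) (inj₂ (inj₂ refl)) ne = ⊥-elim (ne refl)

  InT? : ∀ x → InT x ⊎ OutT x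
  InT? x with x F.≟ u | x F.≟ v | x F.≟ w
  ... | yes e' | _ | _ = inj₁ (inj₁ e')
  ... | no _ | yes e' | _ = inj₁ (inj₂ (inj₁ e'))
  ... | no _ | no _ | yes e' = inj₁ (inj₂ (inj₂ e'))
  ... | no n1 | no n2 | no n3 = inj₂ (n1 , n2 , n3)

  InT-OutT-⊥ : ∀ {x} → InT x → OutT x → ⊥
  InT-OutT-⊥ (inj₁ e') (n1 , _ , _) = n1 e'
  InT-OutT-⊥ (inj₂ (inj₁ e')) (_ , n2 , _) = n2 e'
  InT-OutT-⊥ (inj₂ (inj₂ e')) (_ , _ , n3) = n3 e'

  touchesᵇ : EdgeSet n → Fin n → Bool
  touchesᵇ K q = K ∋[ q , u ] ∨ K ∋[ q , v ] ∨ K ∋[ q , w ]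

  touchesᵇ-intro : ∀ K {q r} → InT r → K ∋[ q , r ] ≡ true → touchesᵇ K q ≡ true
  touchesᵇ-intro K {q} (inj₁ refl) h rewrite h = refl
  touchesᵇ-intro K {q} (inj₂ (inj₁ refl)) h rewrite h = Data.Bool.Properties.∨-zeroʳ (K ∋[ q , u ])
  touchesᵇ-intro K {q} (inj₂ (inj₂ refl)) h rewrite h =
    trans (cong (K ∋[ q , u ] ∨_) (Data.Bool.Properties.∨-zeroʳ (K ∋[ q , v ]))) (Data.Bool.Properties.∨-zeroʳ (K ∋[ q , u ]))

  touchesᵇ-elim : ∀ K q → touchesᵇ K q ≡ true → ∃ λ r → InT r × K ∋[ q , r ] ≡ true
  touchesᵇ-elim K q h with K ∋[ q , u ] in e1 | K ∋[ q , v ] in e2 | K ∋[ q , w ] in e3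
  ... | true | _ | _ = u , inj₁ refl , e1
  ... | false | true | _ = v , inj₂ (inj₁ refl) , e2
  ... | false | false | true = w , inj₂ (inj₂ refl) , e3

  contractedᵇ : EdgeSet n → Fin m → Fin m → Bool
  contractedᵇ K y z with y F.≟ t | z F.≟ t
  ... | yes _ | yes _ = false
  ... | yes _ | no _ = touchesᵇ K (e z)
  ... | no _ | yes _ = touchesᵇ K (e y)
  ... | no _ | no _ = K ∋[ e y , e z ]

  contractedᵇ-tt : ∀ K → contractedᵇ K t t ≡ false
  contractedᵇ-tt K with t F.≟ t
  ... | yes _ = refl
  ... | no ne = ⊥-elim (ne refl)

  contractedᵇ-tz : ∀ K z → z ≢ t → contractedᵇ K t z ≡ touchesᵇ K (e z)
  contractedᵇ-tz K z ne with t F.≟ t | z F.≟ t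
  ... | yes _ | yes e' = ⊥-elim (ne e')
  ... | yes _ | no _ = refl
  ... | no ne' | _ = ⊥-elim (ne' refl)

  contractedᵇ-yt : ∀ K y → y ≢ t → contractedᵇ K y t ≡ touchesᵇ K (e y)
  contractedᵇ-yt K y ne with y F.≟ t | t F.≟ t
  ... | yes e' | _ = ⊥-elim (ne e')
  ... | no _ | yes _ = refl
  ... | no _ | no ne' = ⊥-elim (ne' refl)

  contractedᵇ-yz : ∀ K y z → y ≢ t → z ≢ t → contractedᵇ K y z ≡ K ∋[ e y , e z ]
  contractedᵇ-yz K y z ny nz with y F.≟ t | z F.≟ t
  ... | yes e' | _ = ⊥-elim (ny e')
  ... | no _ | yes e' = ⊥-elim (nz e')
  ... | no _ | no _ = refl

  contractedᵇ-sym : ∀ K → (∀ p q → K ∋[ p , q ] ≡ K ∋[ q , p ]) → ∀ y z → contractedᵇ K y z ≡ contractedᵇ K z y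
  contractedᵇ-sym K Ks y z = decElim (y F.≟ t)
     (λ { refl → decElim (z F.≟ t) (λ { refl → refl }) (λ nz → trans (contractedᵇ-tz K z nz) (sym (contractedᵇ-yt K z nz))) })
     (λ ny → decElim (z F.≟ t) (λ { refl → trans (contractedᵇ-yt K y ny) (sym (contractedᵇ-tz K y ny)) })
                              (λ nz → trans (contractedᵇ-yz K y z ny nz) (trans (Ks _ _) (sym (contractedᵇ-yz K z y nz ny)))))

  contractedᵇ-irrefl : ∀ K → (∀ p → K ∋[ p , p ] ≡ false) → ∀ y → contractedᵇ K y y ≡ false
  contractedᵇ-irrefl K Ki y = decElim (y F.≟ t) (λ { refl → contractedᵇ-tt K }) (λ ny → trans (contractedᵇ-yz K y y ny ny) (Ki _))

  G' : Graph m
  G' = record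
    { adj = tabulate² (contractedᵇ (adj G))
    ; symm = λ y z → trans (lookup-tabulate² (contractedᵇ (adj G)) y z) (trans (contractedᵇ-sym (adj G) (symm G) y z) (sym (lookup-tabulate² (contractedᵇ (adj G)) z y)))
    ; irrefl = λ y → trans (lookup-tabulate² (contractedᵇ (adj G)) y y) (contractedᵇ-irrefl (adj G) (irrefl G) y)
    }

  adj'≡ : ∀ y z → adj G' ∋[ y , z ] ≡ contractedᵇ (adj G) y z
  adj'≡ = lookup-tabulate² (contractedᵇ (adj G))

  notBoth : ∀ x → OutT x → ∀ r r' → InT r → InT r' → r ≢ r' → Adj G x r → Adj G x r' → ⊥
  notBoth x nt r r' tr tr' ne h h' = ne (Pendant-base-unique (pendantOf x r nt tr h) (pendantOf x r' nt tr' h'))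

  boolToℕ-∨-exclusive : ∀ bu bv bw R → (bu ≡ true → bv ≡ true → ⊥) → (bu ≡ true → bw ≡ true → ⊥) → (bv ≡ true → bw ≡ true → ⊥) →
    boolToℕ (bu ∨ bv ∨ bw) + R ≡ boolToℕ bv + (boolToℕ bw + (boolToℕ bu + R))
  boolToℕ-∨-exclusive true true bw R h1 h2 h3 = ⊥-elim (h1 refl refl)
  boolToℕ-∨-exclusive true false true R h1 h2 h3 = ⊥-elim (h2 refl refl)
  boolToℕ-∨-exclusive true false false R h1 h2 h3 = refl
  boolToℕ-∨-exclusive false true true R h1 h2 h3 = ⊥-elim (h3 refl refl)
  boolToℕ-∨-exclusive false true false R h1 h2 h3 = refl
  boolToℕ-∨-exclusive false false true R h1 h2 h3 = refl
  boolToℕ-∨-exclusive false false false R h1 h2 h3 = refl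

  πa = π a
  πb = π b
  πc = π c

  NTa : OutT a
  NTa = a≢u , a≢v , a≢w
  NTb : OutT b
  NTb = b≢u , b≢v , b≢w
  NTc : OutT c
  NTc = c≢u , c≢v , c≢w

  πinj : ∀ {x y} → OutT x → OutT y → π x ≡ π y → x ≡ y
  πinj nx ny h = trans (sym (eπNT _ nx)) (trans (cong e h) (eπNT _ ny))

  tf : true ≢ false
  tf ()

  ex2 : ∀ z → z ≢ t → touchesᵇ (adj G) (e z) ≡ true → z ≡ π a ⊎ z ≡ π b ⊎ z ≡ π c
  ex2 z nz h with touchesᵇ-elim (adj G) (e z) h
  ... | r , tr , hr with pendantOf (e z) r (eNT z nz) tr hr
  ...   | inj₁ (_ , ea) = inj₁ (trans (sym (πe z)) (cong π ea))
  ...   | inj₂ (inj₁ (_ , ec)) = inj₂ (inj₂ (trans (sym (πe z)) (cong π ec)))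
  ...   | inj₂ (inj₂ (_ , eb)) = inj₂ (inj₁ (trans (sym (πe z)) (cong π eb)))

  deg-t : degree G' t ≡ 3
  deg-t = trans (count-cong m _ _ (adj'≡ t))
    (count≡3 m (contractedᵇ (adj G) t) πa πb πc
      (λ h → a≢b (πinj NTa NTb h)) (λ h → a≢c (πinj NTa NTc h)) (λ h → b≢c (πinj NTb NTc h))
      (trans (contractedᵇ-tz (adj G) (π a) (πNT a NTa)) (touchesᵇ-intro (adj G) (inj₁ refl) (subst (λ z → Adj G z u) (sym (eπNT a NTa)) (Adj-sym {G = G} ua))))
      (trans (contractedᵇ-tz (adj G) (π b) (πNT b NTb)) (touchesᵇ-intro (adj G) (inj₂ (inj₂ refl)) (subst (λ z → Adj G z w) (sym (eπNT b NTb)) (Adj-sym {G = G} wb))))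
      (trans (contractedᵇ-tz (adj G) (π c) (πNT c NTc)) (touchesᵇ-intro (adj G) (inj₂ (inj₁ refl)) (subst (λ z → Adj G z v) (sym (eπNT c NTc)) (Adj-sym {G = G} vc))))
      ex)
    where
    ex : ∀ z → contractedᵇ (adj G) t z ≡ true → z ≡ πa ⊎ z ≡ πb ⊎ z ≡ πc
    ex z h = decElim (z F.≟ t) (λ { refl → ⊥-elim (tf (trans (sym h) (contractedᵇ-tt (adj G)))) })
                                 (λ nz → ex2 z nz (trans (sym (contractedᵇ-tz (adj G) z nz)) h))

  deg-y : ∀ y → y ≢ t → degree G' y ≡ 3
  deg-y y ny = begin
      degree G' y ≡⟨ count-cong m _ _ (adj'≡ y) ⟩
      count m (contractedᵇ (adj G) y) ≡⟨ count-punchIn (suc m0) t (contractedᵇ (adj G) y) ⟩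
      boolToℕ (contractedᵇ (adj G) y t) + count (suc m0) (contractedᵇ (adj G) y ∘ punchIn t)
        ≡⟨ cong₂ _+_ (cong boolToℕ (contractedᵇ-yt (adj G) y ny)) (count-cong (suc m0) _ _ (λ j → contractedᵇ-yz (adj G) y _ ny (FP.punchInᵢ≢i t j))) ⟩
      boolToℕ (touchesᵇ (adj G) x) + R
        ≡⟨ boolToℕ-∨-exclusive (q u) (q v) (q w) R (notBoth x nt u v (inj₁ refl) (inj₂ (inj₁ refl)) u≢v)
                  (notBoth x nt u w (inj₁ refl) (inj₂ (inj₂ refl)) (λ h → w≢u (sym h)))
                  (notBoth x nt v w (inj₂ (inj₁ refl)) (inj₂ (inj₂ refl)) v≢w) ⟩
      boolToℕ (q v) + (boolToℕ (q w) + (boolToℕ (q u) + R))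
        ≡⟨ cong₂ (λ z z' → boolToℕ (q v) + (boolToℕ (q z) + (boolToℕ (q z') + R))) (sym (FP.punchIn-punchOut v≢w)) (sym et) ⟩
      boolToℕ (q v) + (boolToℕ (q (punchIn v w')) + (boolToℕ (q (e t)) + R))
        ≡⟨ cong (λ z → boolToℕ (q v) + (boolToℕ (q (punchIn v w')) + z)) (sym (count-punchIn (suc m0) t (q ∘ e))) ⟩
      boolToℕ (q v) + (boolToℕ (q (punchIn v w')) + count m (q ∘ e))
        ≡⟨ cong (boolToℕ (q v) +_) (sym (count-punchIn m w' (q ∘ punchIn v))) ⟩
      boolToℕ (q v) + count (suc m) (q ∘ punchIn v) ≡⟨ sym (count-punchIn (suc m) v q) ⟩
      count n q ≡⟨ cub x ⟩
      3 ∎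
    where
    x = e y
    nt = eNT y ny
    q : Fin n → Bool
    q z = adj G ∋[ x , z ]
    R = count (suc m0) (q ∘ e ∘ punchIn t)

  G'-cubic : Cubic G'
  G'-cubic y = decElim (y F.≟ t) (λ { refl → deg-t }) (deg-y y)

  EπNT : ∀ {x y p q} → OutT x → OutT y → SameEdge x y p q → SameEdge (π x) (π y) (π p) (π q)
  EπNT nx ny (inj₁ (refl , refl)) = inj₁ (refl , refl)
  EπNT nx ny (inj₂ (refl , refl)) = inj₂ (refl , refl)

  Ep-tri : ∀ {x y p q} → OutT x → OutT y → InT p → SameEdge x y p q → ⊥
  Ep-tri nx ny tp (inj₁ (refl , _)) = InT-OutT-⊥ tp nx
  Ep-tri nx ny tp (inj₂ (refl , _)) = InT-OutT-⊥ tp ny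

  Eq-tri : ∀ {x y p q} → OutT x → OutT y → InT q → SameEdge x y p q → ⊥
  Eq-tri nx ny tq (inj₁ (_ , refl)) = InT-OutT-⊥ tq ny
  Eq-tri nx ny tq (inj₂ (_ , refl)) = InT-OutT-⊥ tq nx

  boolEq : ∀ {a b : Bool} → (a ≡ true → b ≡ true) → (b ≡ true → a ≡ true) → a ≡ b
  boolEq {true} {true} f g = refl
  boolEq {false} {false} f g = refl
  boolEq {true} {false} f g = sym (f refl)
  boolEq {false} {true} f g = g refl

  h4 : 4 ≤ n
  h4 = s≤s (s≤s (s≤s (s≤s z≤n)))

  m≥3 : 3 ≤ m
  m≥3 = s≤s (s≤s m0≥1)

  SameEdge-congˡ : ∀ {k} {x y x' y' p q : Fin k} → x ≡ x' → y ≡ y' → SameEdge x y p q → SameEdge x' y' p q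
  SameEdge-congˡ refl refl h = h

  contract : EdgeSet n → EdgeSet m
  contract H = tabulate² (contractedᵇ H)

  b1 : ∀ {j} → suc j < m → 3 + j < n
  b1 h = s≤s (s≤s h)

  module ContractTour (H : EdgeSet n) (cy : Tour G H) (t0 : InT (Tour.s cy 0)) (t1 : InT (Tour.s cy 1)) (t2 : InT (Tour.s cy 2)) where
    open TourProperties cy

    lt0 : 0 < n
    lt0 = s≤s z≤n
    lt1 : 1 < n
    lt1 = s≤s (s≤s z≤n)
    lt2 : 2 < n
    lt2 = s≤s (s≤s (s≤s z≤n))

    triPos : ∀ k → k < n → InT (s k) → k ≡ 0 ⊎ k ≡ 1 ⊎ k ≡ 2
    triPos k k< tk with InT-cover t0 t1 t2 (s-distinct 0 1 lt0 lt1 (λ ())) (s-distinct 0 2 lt0 lt2 (λ ())) (s-distinct 1 2 lt1 lt2 (λ ())) (s k) tk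
    ... | inj₁ h = inj₁ (inj k 0 k< lt0 h)
    ... | inj₂ (inj₁ h) = inj₂ (inj₁ (inj k 1 k< lt1 h))
    ... | inj₂ (inj₂ h) = inj₂ (inj₂ (inj k 2 k< lt2 h))

    ntPos : ∀ i → 3 + i < n → OutT (s (3 + i))
    ntPos i lt with InT? (s (3 + i))
    ... | inj₂ nt = nt
    ... | inj₁ tr with triPos (3 + i) lt tr
    ...   | inj₁ ()
    ...   | inj₂ (inj₁ ())
    ...   | inj₂ (inj₂ ())

    sn0 : s n ≡ s 0
    sn0 = period 0

    tn : InT (s n)
    tn = subst InT (sym sn0) t0

    φ' : ℕ → Fin m
    φ' zero = t
    φ' (suc j) = π (s (3 + j))

    φ'inj : ∀ a b → a < m → b < m → φ' a ≡ φ' b → a ≡ b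
    φ'inj zero zero _ _ _ = refl
    φ'inj zero (suc j) _ bj h = ⊥-elim (πNT _ (ntPos j (b1 bj)) (sym h))
    φ'inj (suc i) zero ai _ h = ⊥-elim (πNT _ (ntPos i (b1 ai)) h)
    φ'inj (suc i) (suc j) ai bj h =
      cong suc (NP.suc-injective (NP.suc-injective (NP.suc-injective
        (inj (3 + i) (3 + j) (b1 ai) (b1 bj) (πinj (ntPos i (b1 ai)) (ntPos j (b1 bj)) h)))))

    φ'adj : ∀ j → suc j < m → Adj G' (φ' j) (φ' (suc j))
    φ'adj zero _ = trans (adj'≡ t (π (s 3))) (trans (contractedᵇ-tz (adj G) (π (s 3)) (πNT _ nt3))
        (touchesᵇ-intro (adj G) t2 (subst (λ x → Adj G x (s 2)) (sym (eπNT _ nt3)) (Adj-sym {G = G} (adjacent 2)))))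
      where
      nt3 = ntPos 0 (s≤s (s≤s (s≤s (s≤s z≤n))))
    φ'adj (suc i) h = trans (adj'≡ (π (s (3 + i))) (π (s (4 + i)))) (trans (contractedᵇ-yz (adj G) (π (s (3 + i))) (π (s (4 + i))) (πNT _ n1) (πNT _ n2))
        (Adj-cong {G = G} (eπNT _ n1) (eπNT _ n2) (adjacent (3 + i))))
      where
      n1 = ntPos i (b1 (NP.<-trans (NP.n<1+n (suc i)) h))
      n2 = ntPos (suc i) (b1 h)

    φ'wrap : ∀ j → suc j ≡ m → Adj G' (φ' j) (φ' 0)
    φ'wrap zero ()
    φ'wrap (suc i) eq with NP.suc-injective (NP.suc-injective eq)
    ... | refl = trans (adj'≡ (π (s (3 + m0))) t) (trans (contractedᵇ-yt (adj G) (π (s (3 + m0))) (πNT _ n3))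
          (touchesᵇ-intro (adj G) t0 (subst (λ x → Adj G x (s 0)) (sym (eπNT _ n3)) (subst (Adj G (s (3 + m0))) sn0 (adjacent (3 + m0))))))
      where
      n3 = ntPos m0 NP.≤-refl

    split3 : ∀ i → 3 + i < n → i < m0 ⊎ i ≡ m0
    split3 i lt with NP.m≤n⇒m<n∨m≡n (NP.≤-pred (NP.≤-pred (NP.≤-pred (NP.≤-pred lt))))
    ... | inj₁ l = inj₁ l
    ... | inj₂ e' = inj₂ e'

    edge-outer : ∀ y z → y ≢ t → z ≢ t → H ∋[ e y , e z ] ≡ true → CyclicStep m φ' y z
    edge-outer y z ny nz h with edge⇒step< (e y) (e z) h
    ... | zero , _ , E' = ⊥-elim (Ep-tri (eNT y ny) (eNT z nz) t0 E')
    ... | suc zero , _ , E' = ⊥-elim (Ep-tri (eNT y ny) (eNT z nz) t1 E')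
    ... | suc (suc zero) , _ , E' = ⊥-elim (Ep-tri (eNT y ny) (eNT z nz) t2 E')
    ... | suc (suc (suc i)) , lt , E' with split3 i lt
    ...   | inj₁ l = inj₁ (suc i , s≤s (s≤s l) , SameEdge-congˡ (πe y) (πe z) (EπNT (eNT y ny) (eNT z nz) E'))
    ...   | inj₂ refl = ⊥-elim (Eq-tri (eNT y ny) (eNT z nz) tn E')

    edge-at-t : ∀ z → z ≢ t → touchesᵇ H (e z) ≡ true → CyclicStep m φ' t z
    edge-at-t z nz h with touchesᵇ-elim H (e z) h
    ... | r , tr , hr with edge⇒step< (e z) r hr
    ... | zero , _ , inj₁ (e1 , _) = ⊥-elim (InT-OutT-⊥ t0 (subst OutT e1 (eNT z nz)))
    ... | zero , _ , inj₂ (_ , e1) = ⊥-elim (InT-OutT-⊥ t1 (subst OutT e1 (eNT z nz)))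
    ... | suc zero , _ , inj₁ (e1 , _) = ⊥-elim (InT-OutT-⊥ t1 (subst OutT e1 (eNT z nz)))
    ... | suc zero , _ , inj₂ (_ , e1) = ⊥-elim (InT-OutT-⊥ t2 (subst OutT e1 (eNT z nz)))
    ... | suc (suc zero) , _ , inj₁ (e1 , _) = ⊥-elim (InT-OutT-⊥ t2 (subst OutT e1 (eNT z nz)))
    ... | suc (suc zero) , _ , inj₂ (_ , e1) = inj₁ (0 , s≤s (s≤s z≤n) , inj₁ (refl , trans (sym (πe z)) (cong π e1)))
    ... | suc (suc (suc i)) , lt , E' with split3 i lt
    ...   | inj₁ l = ⊥-elim (f E')
      where
      f : SameEdge (e z) r (s (3 + i)) (s (4 + i)) → ⊥
      f (inj₁ (_ , e1)) = InT-OutT-⊥ tr (subst OutT (sym e1) (ntPos (suc i) (s≤s (s≤s (s≤s (s≤s l))))))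
      f (inj₂ (e1 , _)) = InT-OutT-⊥ tr (subst OutT (sym e1) (ntPos i lt))
    ...   | inj₂ refl = f E'
      where
      f : SameEdge (e z) r (s (3 + m0)) (s n) → CyclicStep m φ' t z
      f (inj₁ (e1 , _)) = inj₂ (suc m0 , refl , inj₂ (trans (sym (πe z)) (cong π e1) , refl))
      f (inj₂ (e1 , _)) = ⊥-elim (InT-OutT-⊥ tr (subst OutT (sym e1) (ntPos m0 lt)))

    edge⇒cyclicStep : ∀ y z → contract H ∋[ y , z ] ≡ true → CyclicStep m φ' y z
    edge⇒cyclicStep y z h = decElim (y F.≟ t)
      (λ { refl → decElim (z F.≟ t)
          (λ { refl → ⊥-elim (tf (trans (sym (trans (sym (lookup-tabulate² (contractedᵇ H) t t)) h)) (contractedᵇ-tt H))) })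
          (λ nz → edge-at-t z nz (trans (sym (contractedᵇ-tz H z nz)) (trans (sym (lookup-tabulate² (contractedᵇ H) t z)) h))) })
      (λ ny → decElim (z F.≟ t)
          (λ { refl → CyclicStep-swap (edge-at-t y ny (trans (sym (contractedᵇ-yt H y ny)) (trans (sym (lookup-tabulate² (contractedᵇ H) y t)) h))) })
          (λ nz → edge-outer y z ny nz (trans (sym (contractedᵇ-yz H y z ny nz)) (trans (sym (lookup-tabulate² (contractedᵇ H) y z)) h))))

    H32 : H ∋[ e (π (s 3)) , s 2 ] ≡ true
    H32 = subst (λ x → H ∋[ x , s 2 ] ≡ true) (sym (eπNT _ (ntPos 0 (s≤s (s≤s (s≤s (s≤s z≤n))))))) (H-sym (H-step 2))

    pathStep⇒edge : ∀ y z j → suc j < m → SameEdge y z (φ' j) (φ' (suc j)) → contract H ∋[ y , z ] ≡ true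
    pathStep⇒edge y z zero _ (inj₁ (refl , refl)) = trans (lookup-tabulate² (contractedᵇ H) t (π (s 3))) (trans (contractedᵇ-tz H (π (s 3)) (πNT _ (ntPos 0 (s≤s (s≤s (s≤s (s≤s z≤n))))))) (touchesᵇ-intro H t2 H32))
    pathStep⇒edge y z zero _ (inj₂ (refl , refl)) = trans (lookup-tabulate² (contractedᵇ H) (π (s 3)) t) (trans (contractedᵇ-yt H (π (s 3)) (πNT _ (ntPos 0 (s≤s (s≤s (s≤s (s≤s z≤n))))))) (touchesᵇ-intro H t2 H32))
    pathStep⇒edge y z (suc i) lt (inj₁ (refl , refl)) = trans (lookup-tabulate² (contractedᵇ H) (π (s (3 + i))) (π (s (4 + i)))) (trans (contractedᵇ-yz H (π (s (3 + i))) (π (s (4 + i))) (πNT _ n1) (πNT _ n2))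
        (subst₂ (λ x x' → H ∋[ x , x' ] ≡ true) (sym (eπNT _ n1)) (sym (eπNT _ n2)) (H-step (3 + i))))
      where
      n1 = ntPos i (b1 (NP.<-trans (NP.n<1+n (suc i)) lt))
      n2 = ntPos (suc i) (b1 lt)
    pathStep⇒edge y z (suc i) lt (inj₂ (refl , refl)) = trans (lookup-tabulate² (contractedᵇ H) (π (s (4 + i))) (π (s (3 + i)))) (trans (contractedᵇ-yz H (π (s (4 + i))) (π (s (3 + i))) (πNT _ n2) (πNT _ n1))
        (subst₂ (λ x x' → H ∋[ x , x' ] ≡ true) (sym (eπNT _ n2)) (sym (eπNT _ n1)) (H-sym (H-step (3 + i)))))
      where
      n1 = ntPos i (b1 (NP.<-trans (NP.n<1+n (suc i)) lt))
      n2 = ntPos (suc i) (b1 lt)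

    Hlast : H ∋[ e (π (s (3 + m0))) , s 0 ] ≡ true
    Hlast = subst₂ (λ x x' → H ∋[ x , x' ] ≡ true) (sym (eπNT _ (ntPos m0 NP.≤-refl))) sn0 (H-step (3 + m0))

    closingStep⇒edge : ∀ y z j → suc j ≡ m → SameEdge y z (φ' j) (φ' 0) → contract H ∋[ y , z ] ≡ true
    closingStep⇒edge y z zero ()
    closingStep⇒edge y z (suc i) eq E' with NP.suc-injective (NP.suc-injective eq)
    closingStep⇒edge y z (suc i) eq (inj₁ (refl , refl)) | refl = trans (lookup-tabulate² (contractedᵇ H) (π (s (3 + m0))) t) (trans (contractedᵇ-yt H (π (s (3 + m0))) (πNT _ (ntPos m0 NP.≤-refl))) (touchesᵇ-intro H t0 Hlast))
    closingStep⇒edge y z (suc i) eq (inj₂ (refl , refl)) | refl = trans (lookup-tabulate² (contractedᵇ H) t (π (s (3 + m0)))) (trans (contractedᵇ-tz H (π (s (3 + m0))) (πNT _ (ntPos m0 NP.≤-refl))) (touchesᵇ-intro H t0 Hlast))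

    isHamCycle : IsHamCycle G' (contract H)
    isHamCycle = toIsHamCycle (tourFromPath m0 G' (contract H) m≥3 φ' φ'inj φ'adj φ'wrap edge⇒cyclicStep pathStep⇒edge closingStep⇒edge)

  data Location (x : Fin n) : Set where
    isU : x ≡ u → Location x
    isV : x ≡ v → Location x
    isW : x ≡ w → Location x
    out : OutT x → Location x

  location : ∀ x → Location x
  location x with InT? x
  ... | inj₁ (inj₁ e') = isU e'
  ... | inj₁ (inj₂ (inj₁ e')) = isV e'
  ... | inj₁ (inj₂ (inj₂ e')) = isW e'
  ... | inj₂ nt = out nt

  neq01 : u ≢ v
  neq01 = u≢v
  neq02 : u ≢ w
  neq02 h = w≢u (sym h)
  neq10 : v ≢ u
  neq10 h = u≢v (sym h)
  neq12 : v ≢ w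
  neq12 = v≢w
  neq20 : w ≢ u
  neq20 = w≢u
  neq21 : w ≢ v
  neq21 h = v≢w (sym h)

  -- A triangle edge rr' is used iff the tour of G' leaves t towards the vertex
  -- pendant to the third triangle vertex.
  expandedᵇ : EdgeSet m → Fin n → Fin n → Bool
  expandedᵇ H' p q with location p | location q
  ... | out _ | out _ = H' ∋[ π p , π q ]
  ... | out _ | isU _ = H' ∋[ π p , t ] ∧ adj G ∋[ p , q ]
  ... | out _ | isV _ = H' ∋[ π p , t ] ∧ adj G ∋[ p , q ]
  ... | out _ | isW _ = H' ∋[ π p , t ] ∧ adj G ∋[ p , q ]
  ... | isU _ | out _ = H' ∋[ t , π q ] ∧ adj G ∋[ p , q ]
  ... | isV _ | out _ = H' ∋[ t , π q ] ∧ adj G ∋[ p , q ]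
  ... | isW _ | out _ = H' ∋[ t , π q ] ∧ adj G ∋[ p , q ]
  ... | isU _ | isU _ = false
  ... | isU _ | isV _ = H' ∋[ t , π b ]
  ... | isU _ | isW _ = H' ∋[ t , π c ]
  ... | isV _ | isU _ = H' ∋[ t , π b ]
  ... | isV _ | isV _ = false
  ... | isV _ | isW _ = H' ∋[ t , π a ]
  ... | isW _ | isU _ = H' ∋[ t , π c ]
  ... | isW _ | isV _ = H' ∋[ t , π a ]
  ... | isW _ | isW _ = false

  expandedᵇ-oo : ∀ H' p q → OutT p → OutT q → expandedᵇ H' p q ≡ H' ∋[ π p , π q ]
  expandedᵇ-oo H' p q np nq with location p | location q
  ... | out _ | out _ = refl
  ... | isU e' | _ = ⊥-elim (InT-OutT-⊥ (inj₁ e') np)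
  ... | isV e' | _ = ⊥-elim (InT-OutT-⊥ (inj₂ (inj₁ e')) np)
  ... | isW e' | _ = ⊥-elim (InT-OutT-⊥ (inj₂ (inj₂ e')) np)
  ... | out _ | isU e' = ⊥-elim (InT-OutT-⊥ (inj₁ e') nq)
  ... | out _ | isV e' = ⊥-elim (InT-OutT-⊥ (inj₂ (inj₁ e')) nq)
  ... | out _ | isW e' = ⊥-elim (InT-OutT-⊥ (inj₂ (inj₂ e')) nq)

  expandedᵇ-to : ∀ H' p q → InT p → OutT q → expandedᵇ H' p q ≡ H' ∋[ t , π q ] ∧ adj G ∋[ p , q ]
  expandedᵇ-to H' p q tp nq with location p | location q
  ... | out np | _ = ⊥-elim (InT-OutT-⊥ tp np)
  ... | isU _ | out _ = refl
  ... | isV _ | out _ = refl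
  ... | isW _ | out _ = refl
  ... | isU _ | isU e' = ⊥-elim (InT-OutT-⊥ (inj₁ e') nq)
  ... | isU _ | isV e' = ⊥-elim (InT-OutT-⊥ (inj₂ (inj₁ e')) nq)
  ... | isU _ | isW e' = ⊥-elim (InT-OutT-⊥ (inj₂ (inj₂ e')) nq)
  ... | isV _ | isU e' = ⊥-elim (InT-OutT-⊥ (inj₁ e') nq)
  ... | isV _ | isV e' = ⊥-elim (InT-OutT-⊥ (inj₂ (inj₁ e')) nq)
  ... | isV _ | isW e' = ⊥-elim (InT-OutT-⊥ (inj₂ (inj₂ e')) nq)
  ... | isW _ | isU e' = ⊥-elim (InT-OutT-⊥ (inj₁ e') nq)
  ... | isW _ | isV e' = ⊥-elim (InT-OutT-⊥ (inj₂ (inj₁ e')) nq)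
  ... | isW _ | isW e' = ⊥-elim (InT-OutT-⊥ (inj₂ (inj₂ e')) nq)

  expandedᵇ-ot : ∀ H' p q → OutT p → InT q → expandedᵇ H' p q ≡ H' ∋[ π p , t ] ∧ adj G ∋[ p , q ]
  expandedᵇ-ot H' p q np tq with location p | location q
  ... | _ | out nq = ⊥-elim (InT-OutT-⊥ tq nq)
  ... | out _ | isU _ = refl
  ... | out _ | isV _ = refl
  ... | out _ | isW _ = refl
  ... | isU e' | _ = ⊥-elim (InT-OutT-⊥ (inj₁ e') np)
  ... | isV e' | _ = ⊥-elim (InT-OutT-⊥ (inj₂ (inj₁ e')) np)
  ... | isW e' | _ = ⊥-elim (InT-OutT-⊥ (inj₂ (inj₂ e')) np)

  expandedᵇ-tt : ∀ H' p q → InT p → InT q → p ≢ q → ∀ r x → r ≢ p → r ≢ q → Pendant u v w a b c r x → expandedᵇ H' p q ≡ H' ∋[ t , π x ]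
  expandedᵇ-tt H' p q tp tq pq r x rp rq ex with location p | location q
  ... | out np | _ = ⊥-elim (InT-OutT-⊥ tp np)
  ... | _ | out nq = ⊥-elim (InT-OutT-⊥ tq nq)
  expandedᵇ-tt H' p q tp tq pq r x rp rq ex | isU refl | isU refl = ⊥-elim (pq refl)
  expandedᵇ-tt H' p q tp tq pq r x rp rq (inj₁ (refl , refl)) | isU refl | isV refl = ⊥-elim (rp refl)
  expandedᵇ-tt H' p q tp tq pq r x rp rq (inj₂ (inj₁ (refl , refl))) | isU refl | isV refl = ⊥-elim (rq refl)
  expandedᵇ-tt H' p q tp tq pq r x rp rq (inj₂ (inj₂ (refl , refl))) | isU refl | isV refl = refl
  expandedᵇ-tt H' p q tp tq pq r x rp rq (inj₁ (refl , refl)) | isU refl | isW refl = ⊥-elim (rp refl)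
  expandedᵇ-tt H' p q tp tq pq r x rp rq (inj₂ (inj₁ (refl , refl))) | isU refl | isW refl = refl
  expandedᵇ-tt H' p q tp tq pq r x rp rq (inj₂ (inj₂ (refl , refl))) | isU refl | isW refl = ⊥-elim (rq refl)
  expandedᵇ-tt H' p q tp tq pq r x rp rq (inj₁ (refl , refl)) | isV refl | isU refl = ⊥-elim (rq refl)
  expandedᵇ-tt H' p q tp tq pq r x rp rq (inj₂ (inj₁ (refl , refl))) | isV refl | isU refl = ⊥-elim (rp refl)
  expandedᵇ-tt H' p q tp tq pq r x rp rq (inj₂ (inj₂ (refl , refl))) | isV refl | isU refl = refl
  expandedᵇ-tt H' p q tp tq pq r x rp rq ex | isV refl | isV refl = ⊥-elim (pq refl)
  expandedᵇ-tt H' p q tp tq pq r x rp rq (inj₁ (refl , refl)) | isV refl | isW refl = refl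
  expandedᵇ-tt H' p q tp tq pq r x rp rq (inj₂ (inj₁ (refl , refl))) | isV refl | isW refl = ⊥-elim (rp refl)
  expandedᵇ-tt H' p q tp tq pq r x rp rq (inj₂ (inj₂ (refl , refl))) | isV refl | isW refl = ⊥-elim (rq refl)
  expandedᵇ-tt H' p q tp tq pq r x rp rq (inj₁ (refl , refl)) | isW refl | isU refl = ⊥-elim (rq refl)
  expandedᵇ-tt H' p q tp tq pq r x rp rq (inj₂ (inj₁ (refl , refl))) | isW refl | isU refl = refl
  expandedᵇ-tt H' p q tp tq pq r x rp rq (inj₂ (inj₂ (refl , refl))) | isW refl | isU refl = ⊥-elim (rp refl)
  expandedᵇ-tt H' p q tp tq pq r x rp rq (inj₁ (refl , refl)) | isW refl | isV refl = refl
  expandedᵇ-tt H' p q tp tq pq r x rp rq (inj₂ (inj₁ (refl , refl))) | isW refl | isV refl = ⊥-elim (rq refl)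
  expandedᵇ-tt H' p q tp tq pq r x rp rq (inj₂ (inj₂ (refl , refl))) | isW refl | isV refl = ⊥-elim (rp refl)
  expandedᵇ-tt H' p q tp tq pq r x rp rq ex | isW refl | isW refl = ⊥-elim (pq refl)

  expandedᵇ-irrefl : ∀ H' p → InT p → expandedᵇ H' p p ≡ false
  expandedᵇ-irrefl H' p tp with location p | location p
  ... | out np | _ = ⊥-elim (InT-OutT-⊥ tp np)
  ... | _ | out np = ⊥-elim (InT-OutT-⊥ tp np)
  ... | isU _ | isU _ = refl
  ... | isU e1 | isV e2 = ⊥-elim (neq01 (trans (sym e1) e2))
  ... | isU e1 | isW e2 = ⊥-elim (neq02 (trans (sym e1) e2))
  ... | isV e1 | isU e2 = ⊥-elim (neq10 (trans (sym e1) e2))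
  ... | isV _ | isV _ = refl
  ... | isV e1 | isW e2 = ⊥-elim (neq12 (trans (sym e1) e2))
  ... | isW e1 | isU e2 = ⊥-elim (neq20 (trans (sym e1) e2))
  ... | isW e1 | isV e2 = ⊥-elim (neq21 (trans (sym e1) e2))
  ... | isW _ | isW _ = refl

  expand : EdgeSet m → EdgeSet n
  expand H' = tabulate² (expandedᵇ H')

  ∧-intro : ∀ {x y} → x ≡ true → y ≡ true → x ∧ y ≡ true
  ∧-intro refl refl = refl

  pairE : ∀ {p q A B Z : Fin n} → p ≡ A ⊎ p ≡ B ⊎ p ≡ Z → q ≡ A ⊎ q ≡ B ⊎ q ≡ Z → p ≢ Z → q ≢ Z → p ≢ q → SameEdge p q A B
  pairE (inj₁ e1) (inj₁ e2) pc qc pq = ⊥-elim (pq (trans e1 (sym e2)))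
  pairE (inj₁ e1) (inj₂ (inj₁ e2)) pc qc pq = inj₁ (e1 , e2)
  pairE (inj₂ (inj₁ e1)) (inj₁ e2) pc qc pq = inj₂ (e2 , e1)
  pairE (inj₂ (inj₁ e1)) (inj₂ (inj₁ e2)) pc qc pq = ⊥-elim (pq (trans e1 (sym e2)))
  pairE (inj₂ (inj₂ e1)) _ pc qc pq = ⊥-elim (pc e1)
  pairE (inj₁ _) (inj₂ (inj₂ e2)) pc qc pq = ⊥-elim (qc e2)
  pairE (inj₂ (inj₁ _)) (inj₂ (inj₂ e2)) pc qc pq = ⊥-elim (qc e2)

  rot3 : ∀ {p A B Z : Fin n} → p ≡ A ⊎ p ≡ B ⊎ p ≡ Z → p ≡ B ⊎ p ≡ Z ⊎ p ≡ A
  rot3 (inj₁ e1) = inj₂ (inj₂ e1)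
  rot3 (inj₂ (inj₁ e1)) = inj₁ e1
  rot3 (inj₂ (inj₂ e1)) = inj₂ (inj₁ e1)

  h3n : 3 ≤ n
  h3n = s≤s (s≤s (s≤s z≤n))

  module ExpandTour (H' : EdgeSet m) (cy : Tour G' H') (st : Tour.s cy 0 ≡ t) where
    open TourProperties cy

    ltm0 : 0 < m
    ltm0 = s≤s z≤n
    ltm1 : 1 < m
    ltm1 = s≤s (s≤s z≤n)

    ntS : ∀ j → suc j < m → s (suc j) ≢ t
    ntS j lt h = s-distinct (suc j) 0 lt ltm0 (λ ()) (trans h (sym st))

    y1 = s 1
    y0 = s (suc m0)

    y1t : y1 ≢ t
    y1t = ntS 0 ltm1
    y0t : y0 ≢ t
    y0t = ntS m0 NP.≤-refl

    A1 : Adj G' t y1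
    A1 = subst (λ x → Adj G' x y1) st (adjacent 0)
    A0 : Adj G' y0 t
    A0 = subst (Adj G' y0) (trans (s-suc-prev 0) st) (adjacent (suc m0))

    TK1 : touchesᵇ (adj G) (e y1) ≡ true
    TK1 = trans (sym (contractedᵇ-tz (adj G) y1 y1t)) (trans (sym (adj'≡ t y1)) A1)
    TK0 : touchesᵇ (adj G) (e y0) ≡ true
    TK0 = trans (sym (contractedᵇ-yt (adj G) y0 y0t)) (trans (sym (adj'≡ y0 t)) A0)

    Yd = touchesᵇ-elim (adj G) (e y1) TK1
    Xd = touchesᵇ-elim (adj G) (e y0) TK0
    Y = proj₁ Yd
    X = proj₁ Xd
    tY : InT Y
    tY = proj₁ (proj₂ Yd)
    tX : InT X
    tX = proj₁ (proj₂ Xd)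
    adjY : Adj G (e y1) Y
    adjY = proj₂ (proj₂ Yd)
    adjX : Adj G (e y0) X
    adjX = proj₂ (proj₂ Xd)
    ExtY : Pendant u v w a b c Y (e y1)
    ExtY = pendantOf (e y1) Y (eNT y1 y1t) tY adjY
    ExtX : Pendant u v w a b c X (e y0)
    ExtX = pendantOf (e y0) X (eNT y0 y0t) tX adjX

    X≢Y : X ≢ Y
    X≢Y h = s-suc≢s-prev 0 (e-inj (sym (Pendant-unique (subst (λ r → Pendant u v w a b c r (e y0)) h ExtX) ExtY)))

    Md = InT-third tX tY X≢Y
    M = proj₁ Md
    tM : InT M
    tM = proj₁ (proj₂ Md)
    M≢X : M ≢ X
    M≢X = proj₁ (proj₂ (proj₂ Md))
    M≢Y : M ≢ Y
    M≢Y = proj₂ (proj₂ (proj₂ Md))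

    covXMY : ∀ r → InT r → r ≡ X ⊎ r ≡ M ⊎ r ≡ Y
    covXMY = InT-cover tX tM tY (λ h → M≢X (sym h)) X≢Y M≢Y

    ψ : ℕ → Fin n
    ψ zero = X
    ψ (suc zero) = M
    ψ (suc (suc zero)) = Y
    ψ (suc (suc (suc j))) = e (s (suc j))

    cv : ∀ {j} → 3 + j < n → suc j < m
    cv h = NP.≤-pred (NP.≤-pred h)

    ntψ : ∀ j → suc j < m → OutT (e (s (suc j)))
    ntψ j lt = eNT _ (ntS j lt)

    trOut : ∀ {r} j → suc j < m → InT r → r ≢ e (s (suc j))
    trOut j lt tr h = InT-OutT-⊥ tr (subst OutT (sym h) (ntψ j lt))

    ψinj : ∀ a b → a < n → b < n → ψ a ≡ ψ b → a ≡ b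
    ψinj zero zero _ _ _ = refl
    ψinj zero (suc zero) _ _ h = ⊥-elim (M≢X (sym h))
    ψinj zero (suc (suc zero)) _ _ h = ⊥-elim (X≢Y h)
    ψinj zero (suc (suc (suc j))) _ lb h = ⊥-elim (trOut j (cv lb) tX h)
    ψinj (suc zero) zero _ _ h = ⊥-elim (M≢X h)
    ψinj (suc zero) (suc zero) _ _ _ = refl
    ψinj (suc zero) (suc (suc zero)) _ _ h = ⊥-elim (M≢Y h)
    ψinj (suc zero) (suc (suc (suc j))) _ lb h = ⊥-elim (trOut j (cv lb) tM h)
    ψinj (suc (suc zero)) zero _ _ h = ⊥-elim (X≢Y (sym h))
    ψinj (suc (suc zero)) (suc zero) _ _ h = ⊥-elim (M≢Y (sym h))
    ψinj (suc (suc zero)) (suc (suc zero)) _ _ _ = refl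
    ψinj (suc (suc zero)) (suc (suc (suc j))) _ lb h = ⊥-elim (trOut j (cv lb) tY h)
    ψinj (suc (suc (suc i))) zero la _ h = ⊥-elim (trOut i (cv la) tX (sym h))
    ψinj (suc (suc (suc i))) (suc zero) la _ h = ⊥-elim (trOut i (cv la) tM (sym h))
    ψinj (suc (suc (suc i))) (suc (suc zero)) la _ h = ⊥-elim (trOut i (cv la) tY (sym h))
    ψinj (suc (suc (suc i))) (suc (suc (suc j))) la lb h = cong (λ z → suc (suc z)) (inj (suc i) (suc j) (cv la) (cv lb) (e-inj h))

    ψadj : ∀ j → suc j < n → Adj G (ψ j) (ψ (suc j))
    ψadj zero _ = InT-Adj tX tM (λ h → M≢X (sym h))
    ψadj (suc zero) _ = InT-Adj tM tY M≢Y
    ψadj (suc (suc zero)) _ = Adj-sym {G = G} adjY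
    ψadj (suc (suc (suc i))) lt = trans (sym (contractedᵇ-yz (adj G) (s (suc i)) (s (suc (suc i))) (ntS i (NP.<-trans (NP.n<1+n (suc i)) (cv lt))) (ntS (suc i) (cv lt))))
                                    (trans (sym (adj'≡ (s (suc i)) (s (suc (suc i))))) (adjacent (suc i)))

    ψwrap : ∀ j → suc j ≡ n → Adj G (ψ j) (ψ 0)
    ψwrap zero ()
    ψwrap (suc zero) ()
    ψwrap (suc (suc zero)) ()
    ψwrap (suc (suc (suc i))) eq with NP.suc-injective (NP.suc-injective (NP.suc-injective (NP.suc-injective eq)))
    ... | refl = adjX

    Ht : ∀ z → H' ∋[ t , z ] ≡ true → z ≡ y1 ⊎ z ≡ y0
    Ht z h = H-nbrs 0 z (subst (λ x → H' ∋[ x , z ] ≡ true) (sym st) h)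

    edge-in-out : ∀ p q → InT p → OutT q → H' ∋[ t , π q ] ≡ true → Adj G p q → CyclicStep n ψ p q
    edge-in-out p q tp nq hq ap = f (Ht (π q) hq)
      where
      exq : Pendant u v w a b c p q
      exq = pendantOf q p nq tp (Adj-sym {G = G} ap)
      f : π q ≡ y1 ⊎ π q ≡ y0 → CyclicStep n ψ p q
      f (inj₁ h) = inj₁ (2 , s≤s (s≤s (s≤s (s≤s z≤n))) , inj₁ (Pendant-base-unique exq (subst (Pendant u v w a b c Y) (sym (trans (sym (eπNT q nq)) (cong e h))) ExtY) ,
                                                             trans (sym (eπNT q nq)) (cong e h)))
      f (inj₂ h) = inj₂ (3 + m0 , refl , inj₂ (trans (sym (eπNT q nq)) (cong e h) ,
                                               Pendant-base-unique exq (subst (Pendant u v w a b c X) (sym (trans (sym (eπNT q nq)) (cong e h))) ExtX)))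

    EeNT : ∀ {p q P Q} → OutT p → OutT q → SameEdge (π p) (π q) P Q → SameEdge p q (e P) (e Q)
    EeNT np nq (inj₁ (h1 , h2)) = inj₁ (trans (sym (eπNT _ np)) (cong e h1) , trans (sym (eπNT _ nq)) (cong e h2))
    EeNT np nq (inj₂ (h1 , h2)) = inj₂ (trans (sym (eπNT _ nq)) (cong e h1) , trans (sym (eπNT _ np)) (cong e h2))

    Et1 : ∀ {p q P Q} → OutT p → OutT q → SameEdge (π p) (π q) P Q → P ≡ t → ⊥
    Et1 np nq (inj₁ (h1 , _)) h = πNT _ np (trans h1 h)
    Et1 np nq (inj₂ (h1 , _)) h = πNT _ nq (trans h1 h)

    Et2 : ∀ {p q P Q} → OutT p → OutT q → SameEdge (π p) (π q) P Q → Q ≡ t → ⊥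
    Et2 np nq (inj₁ (_ , h2)) h = πNT _ nq (trans h2 h)
    Et2 np nq (inj₂ (_ , h2)) h = πNT _ np (trans h2 h)

    edge-out-out : ∀ p q → OutT p → OutT q → H' ∋[ π p , π q ] ≡ true → CyclicStep n ψ p q
    edge-out-out p q np nq h with edge⇒step< (π p) (π q) h
    ... | zero , _ , E' = ⊥-elim (Et1 np nq E' st)
    ... | suc i , lt , E' with NP.m≤n⇒m<n∨m≡n lt
    ...   | inj₁ l = inj₁ (3 + i , s≤s (s≤s l) , EeNT np nq E')
    ...   | inj₂ eq = ⊥-elim (Et2 np nq E' (trans (cong s eq) (trans (period 0) st)))

    edge-in-in : ∀ p q → InT p → InT q → p ≢ q → expandedᵇ H' p q ≡ true → CyclicStep n ψ p q
    edge-in-in p q tp tq pq h = f (Ht (π x) (trans (sym (expandedᵇ-tt H' p q tp tq pq r x rp rq ex)) h))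
      where
      r = proj₁ (InT-third tp tq pq)
      tr : InT r
      tr = proj₁ (proj₂ (InT-third tp tq pq))
      rp : r ≢ p
      rp = proj₁ (proj₂ (proj₂ (InT-third tp tq pq)))
      rq : r ≢ q
      rq = proj₂ (proj₂ (proj₂ (InT-third tp tq pq)))
      x = proj₁ (pendantAt r tr)
      ex : Pendant u v w a b c r x
      ex = proj₂ (pendantAt r tr)
      xe : ∀ {y} → π x ≡ y → x ≡ e y
      xe h' = trans (sym (eπNT x (Pendant-OutT ex))) (cong e h')
      f : π x ≡ y1 ⊎ π x ≡ y0 → CyclicStep n ψ p q
      f (inj₁ h') = inj₁ (0 , s≤s (s≤s z≤n) , pairE (covXMY p tp) (covXMY q tq) (λ e' → rp (trans rY (sym e'))) (λ e' → rq (trans rY (sym e'))) pq)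
        where
        rY : r ≡ Y
        rY = Pendant-base-unique ex (subst (Pendant u v w a b c Y) (sym (xe h')) ExtY)
      f (inj₂ h') = inj₁ (1 , s≤s (s≤s (s≤s z≤n)) , pairE (rot3 (covXMY p tp)) (rot3 (covXMY q tq)) (λ e' → rp (trans rX (sym e'))) (λ e' → rq (trans rX (sym e'))) pq)
        where
        rX : r ≡ X
        rX = Pendant-base-unique ex (subst (Pendant u v w a b c X) (sym (xe h')) ExtX)

    edge⇒cyclicStep-cases : ∀ p q → InT p ⊎ OutT p → InT q ⊎ OutT q → expandedᵇ H' p q ≡ true → CyclicStep n ψ p q
    edge⇒cyclicStep-cases p q (inj₂ np) (inj₂ nq) h = edge-out-out p q np nq (trans (sym (expandedᵇ-oo H' p q np nq)) h)
    edge⇒cyclicStep-cases p q (inj₁ tp) (inj₂ nq) h = let (h1 , h2) = ∧≡true⇒ {H' ∋[ t , π q ]} (trans (sym (expandedᵇ-to H' p q tp nq)) h) in edge-in-out p q tp nq h1 h2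
    edge⇒cyclicStep-cases p q (inj₂ np) (inj₁ tq) h = let (h1 , h2) = ∧≡true⇒ {H' ∋[ π p , t ]} (trans (sym (expandedᵇ-ot H' p q np tq)) h) in
                                     CyclicStep-swap (edge-in-out q p tq np (H-sym h1) (Adj-sym {G = G} h2))
    edge⇒cyclicStep-cases p q (inj₁ tp) (inj₁ tq) h = decElim (p F.≟ q) (λ { refl → ⊥-elim (tf (trans (sym h) (expandedᵇ-irrefl H' p tp))) }) (λ pq → edge-in-in p q tp tq pq h)

    edge⇒cyclicStep : ∀ p q → expand H' ∋[ p , q ] ≡ true → CyclicStep n ψ p q
    edge⇒cyclicStep p q h = edge⇒cyclicStep-cases p q (InT? p) (InT? q) (trans (sym (lookup-tabulate² (expandedᵇ H') p q)) h)

    HY : H' ∋[ t , π (e y1) ] ≡ true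
    HY = subst₂ (λ x x' → H' ∋[ x , x' ] ≡ true) st (sym (πe y1)) (H-step 0)
    HX : H' ∋[ t , π (e y0) ] ≡ true
    HX = subst₂ (λ x x' → H' ∋[ x , x' ] ≡ true) st (sym (πe y0)) (H-prev 0)

    pathStep⇒edge : ∀ p q j → suc j < n → SameEdge p q (ψ j) (ψ (suc j)) → expand H' ∋[ p , q ] ≡ true
    pathStep⇒edge p q zero _ (inj₁ (refl , refl)) = trans (lookup-tabulate² (expandedᵇ H') X M) (trans (expandedᵇ-tt H' X M tX tM (λ h → M≢X (sym h)) Y (e y1) (λ h → X≢Y (sym h)) (λ h → M≢Y (sym h)) ExtY) HY)
    pathStep⇒edge p q zero _ (inj₂ (refl , refl)) = trans (lookup-tabulate² (expandedᵇ H') M X) (trans (expandedᵇ-tt H' M X tM tX M≢X Y (e y1) (λ h → M≢Y (sym h)) (λ h → X≢Y (sym h)) ExtY) HY)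
    pathStep⇒edge p q (suc zero) _ (inj₁ (refl , refl)) = trans (lookup-tabulate² (expandedᵇ H') M Y) (trans (expandedᵇ-tt H' M Y tM tY M≢Y X (e y0) (λ h → M≢X (sym h)) X≢Y ExtX) HX)
    pathStep⇒edge p q (suc zero) _ (inj₂ (refl , refl)) = trans (lookup-tabulate² (expandedᵇ H') Y M) (trans (expandedᵇ-tt H' Y M tY tM (λ h → M≢Y (sym h)) X (e y0) X≢Y (λ h → M≢X (sym h)) ExtX) HX)
    pathStep⇒edge p q (suc (suc zero)) _ (inj₁ (refl , refl)) = trans (lookup-tabulate² (expandedᵇ H') Y (e y1)) (trans (expandedᵇ-to H' Y (e y1) tY (eNT y1 y1t)) (∧-intro HY (Adj-sym {G = G} adjY)))
    pathStep⇒edge p q (suc (suc zero)) _ (inj₂ (refl , refl)) = trans (lookup-tabulate² (expandedᵇ H') (e y1) Y) (trans (expandedᵇ-ot H' (e y1) Y (eNT y1 y1t) tY) (∧-intro (H-sym HY) adjY))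
    pathStep⇒edge p q (suc (suc (suc i))) lt (inj₁ (refl , refl)) = trans (lookup-tabulate² (expandedᵇ H') (e (s (suc i))) (e (s (suc (suc i))))) (trans (expandedᵇ-oo H' (e (s (suc i))) (e (s (suc (suc i)))) (ntψ i l1) (ntψ (suc i) (cv lt)))
        (subst₂ (λ x x' → H' ∋[ x , x' ] ≡ true) (sym (πe _)) (sym (πe _)) (H-step (suc i))))
      where
      l1 = NP.<-trans (NP.n<1+n (suc i)) (cv lt)
    pathStep⇒edge p q (suc (suc (suc i))) lt (inj₂ (refl , refl)) = trans (lookup-tabulate² (expandedᵇ H') (e (s (suc (suc i)))) (e (s (suc i)))) (trans (expandedᵇ-oo H' (e (s (suc (suc i)))) (e (s (suc i))) (ntψ (suc i) (cv lt)) (ntψ i l1))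
        (subst₂ (λ x x' → H' ∋[ x , x' ] ≡ true) (sym (πe _)) (sym (πe _)) (H-sym (H-step (suc i)))))
      where
      l1 = NP.<-trans (NP.n<1+n (suc i)) (cv lt)

    closingStep⇒edge : ∀ p q j → suc j ≡ n → SameEdge p q (ψ j) (ψ 0) → expand H' ∋[ p , q ] ≡ true
    closingStep⇒edge p q zero ()
    closingStep⇒edge p q (suc zero) ()
    closingStep⇒edge p q (suc (suc zero)) ()
    closingStep⇒edge p q (suc (suc (suc i))) eq E' with NP.suc-injective (NP.suc-injective (NP.suc-injective (NP.suc-injective eq)))
    closingStep⇒edge p q (suc (suc (suc i))) eq (inj₁ (refl , refl)) | refl = trans (lookup-tabulate² (expandedᵇ H') (e y0) X) (trans (expandedᵇ-ot H' (e y0) X (eNT y0 y0t) tX) (∧-intro (H-sym HX) adjX))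
    closingStep⇒edge p q (suc (suc (suc i))) eq (inj₂ (refl , refl)) | refl = trans (lookup-tabulate² (expandedᵇ H') X (e y0)) (trans (expandedᵇ-to H' X (e y0) tX (eNT y0 y0t)) (∧-intro HX (Adj-sym {G = G} adjX)))

    isHamCycle : IsHamCycle G (expand H')
    isHamCycle = toIsHamCycle (tourFromPath (suc (suc m0)) G (expand H') h3n ψ ψinj ψadj ψwrap edge⇒cyclicStep pathStep⇒edge closingStep⇒edge)

  tabulate²-lookup : ∀ {k} (K : EdgeSet k) (F : Fin k → Fin k → Bool) → (∀ p q → F p q ≡ K ∋[ p , q ]) → tabulate² F ≡ K
  tabulate²-lookup K F h = trans (VP.tabulate-cong (λ p → VP.tabulate-cong (λ q → h p q)))
                      (trans (VP.tabulate-cong (λ p → VP.tabulate∘lookup (V.lookup K p))) (VP.tabulate∘lookup K))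

  contract∘expand-tour : ∀ H' → Tour G' H' → contract (expand H') ≡ H'
  contract∘expand-tour H' cy = tabulate²-lookup H' (contractedᵇ (expand H')) pw
    where
    open TourProperties cy
    GHot : ∀ z r → z ≢ t → InT r → expand H' ∋[ e z , r ] ≡ H' ∋[ z , t ] ∧ adj G ∋[ e z , r ]
    GHot z r nz tr = trans (lookup-tabulate² (expandedᵇ H') (e z) r) (trans (expandedᵇ-ot H' (e z) r (eNT z nz) tr) (cong (λ y → H' ∋[ y , t ] ∧ adj G ∋[ e z , r ]) (πe z)))
    f1 : ∀ z → z ≢ t → touchesᵇ (expand H') (e z) ≡ true → H' ∋[ z , t ] ≡ true
    f1 z nz h with touchesᵇ-elim (expand H') (e z) h
    ... | r , tr , hr = proj₁ (∧≡true⇒ {H' ∋[ z , t ]} (trans (sym (GHot z r nz tr)) hr))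
    g1 : ∀ z → z ≢ t → H' ∋[ z , t ] ≡ true → touchesᵇ (expand H') (e z) ≡ true
    g1 z nz h with touchesᵇ-elim (adj G) (e z) (trans (sym (contractedᵇ-yt (adj G) z nz)) (trans (sym (adj'≡ z t)) (H⇒Adj h)))
    ... | r , tr , ar = touchesᵇ-intro (expand H') {e z} tr (trans (GHot z r nz tr) (∧-intro h ar))
    pw : ∀ y z → contractedᵇ (expand H') y z ≡ H' ∋[ y , z ]
    pw y z = decElim (y F.≟ t)
      (λ { refl → decElim (z F.≟ t)
          (λ { refl → trans (contractedᵇ-tt (expand H')) (sym (H-irrefl t)) })
          (λ nz → trans (contractedᵇ-tz (expand H') z nz) (boolEq (λ h → H-sym (f1 z nz h)) (λ h → g1 z nz (H-sym h)))) })
      (λ ny → decElim (z F.≟ t)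
          (λ { refl → trans (contractedᵇ-yt (expand H') y ny) (boolEq (f1 y ny) (g1 y ny)) })
          (λ nz → trans (contractedᵇ-yz (expand H') y z ny nz) (trans (lookup-tabulate² (expandedᵇ H') (e y) (e z))
                    (trans (expandedᵇ-oo H' (e y) (e z) (eNT y ny) (eNT z nz)) (cong₂ (λ p q → H' ∋[ p , q ]) (πe y) (πe z))))))

  thirdPos : ∀ {p q r A B Z : Fin n} → SameEdge p q A B → r ≢ p → r ≢ q → r ≡ A ⊎ r ≡ B ⊎ r ≡ Z → r ≡ Z
  thirdPos _ rp rq (inj₂ (inj₂ h)) = h
  thirdPos (inj₁ (refl , _)) rp rq (inj₁ h) = ⊥-elim (rp h)
  thirdPos (inj₂ (refl , _)) rp rq (inj₁ h) = ⊥-elim (rq h)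
  thirdPos (inj₁ (_ , refl)) rp rq (inj₂ (inj₁ h)) = ⊥-elim (rq h)
  thirdPos (inj₂ (_ , refl)) rp rq (inj₂ (inj₁ h)) = ⊥-elim (rp h)

  Eptt : ∀ {p q P Q : Fin n} → InT p → InT q → OutT P → SameEdge p q P Q → ⊥
  Eptt tp tq nP (inj₁ (refl , _)) = InT-OutT-⊥ tp nP
  Eptt tp tq nP (inj₂ (refl , _)) = InT-OutT-⊥ tq nP

  Eqtt : ∀ {p q P Q : Fin n} → InT p → InT q → OutT Q → SameEdge p q P Q → ⊥
  Eqtt tp tq nQ (inj₁ (_ , refl)) = InT-OutT-⊥ tq nQ
  Eqtt tp tq nQ (inj₂ (_ , refl)) = InT-OutT-⊥ tp nQ

  module ExpandContract (H : EdgeSet n) (cy : Tour G H) (t0 : InT (Tour.s cy 0)) (t1 : InT (Tour.s cy 1)) (t2 : InT (Tour.s cy 2)) where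
    open ContractTour H cy t0 t1 t2
    open TourProperties cy

    cov : ∀ r → InT r → r ≡ s 0 ⊎ r ≡ s 1 ⊎ r ≡ s 2
    cov = InT-cover t0 t1 t2 (s-distinct 0 1 lt0 lt1 (λ ())) (s-distinct 0 2 lt0 lt2 (λ ())) (s-distinct 1 2 lt1 lt2 (λ ()))

    TKx : ∀ r x → InT r → Pendant u v w a b c r x → touchesᵇ H x ≡ true → H ∋[ x , r ] ≡ true
    TKx r x tr ex h with touchesᵇ-elim H x h
    ... | r' , tr' , hr' = subst (λ z → H ∋[ x , z ] ≡ true) (Pendant-base-unique (pendantOf x r' (Pendant-OutT ex) tr' (H⇒Adj hr')) ex) hr'

    ttf : ∀ p q → InT p → InT q → p ≢ q → ∀ r x → InT r → r ≢ p → r ≢ q → Pendant u v w a b c r x → H ∋[ x , r ] ≡ true → H ∋[ p , q ] ≡ true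
    ttf p q tp tq pq r x tr rp rq ex h with cov r tr
    ... | inj₁ refl = step⇒edge p q 1 (pairE (rot3 (cov p tp)) (rot3 (cov q tq)) (λ e' → rp (sym e')) (λ e' → rq (sym e')) pq)
    ... | inj₂ (inj₁ refl) = ⊥-elim (f (H-nbrs-suc 0 x (H-sym h)))
      where
      f : x ≡ s 2 ⊎ x ≡ s 0 → ⊥
      f (inj₁ e') = InT-OutT-⊥ t2 (subst OutT e' (Pendant-OutT ex))
      f (inj₂ e') = InT-OutT-⊥ t0 (subst OutT e' (Pendant-OutT ex))
    ... | inj₂ (inj₂ refl) = step⇒edge p q 0 (pairE (cov p tp) (cov q tq) (λ e' → rp (sym e')) (λ e' → rq (sym e')) pq)

    nt3 : OutT (s 3)
    nt3 = ntPos 0 (s≤s (s≤s (s≤s (s≤s z≤n))))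
    ntl : OutT (s (3 + m0))
    ntl = ntPos m0 NP.≤-refl

    ttg : ∀ p q → InT p → InT q → ∀ r x → InT r → r ≢ p → r ≢ q → Pendant u v w a b c r x → H ∋[ p , q ] ≡ true → touchesᵇ H x ≡ true
    ttg p q tp tq r x tr rp rq ex h with edge⇒step< p q h
    ... | zero , _ , E' = f (thirdPos E' rp rq (cov r tr))
      where
      f : r ≡ s 2 → touchesᵇ H x ≡ true
      f refl = touchesᵇ-intro H tr (subst (λ z → H ∋[ z , s 2 ] ≡ true) (Pendant-unique (pendantOf (s 3) (s 2) nt3 t2 (Adj-sym {G = G} (adjacent 2))) ex) (H-sym (H-step 2)))
    ... | suc zero , _ , E' = f (thirdPos E' rp rq (rot3 (cov r tr)))
      where
      f : r ≡ s 0 → touchesᵇ H x ≡ true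
      f refl = touchesᵇ-intro H tr (subst (λ z → H ∋[ z , s 0 ] ≡ true) (Pendant-unique (pendantOf (s (3 + m0)) (s 0) ntl t0 (subst (Adj G (s (3 + m0))) sn0 (adjacent (3 + m0)))) ex)
                  (subst (λ z → H ∋[ s (3 + m0) , z ] ≡ true) sn0 (H-step (3 + m0))))
    ... | suc (suc zero) , _ , E' = ⊥-elim (Eqtt tp tq nt3 E')
    ... | suc (suc (suc i)) , lt , E' = ⊥-elim (Eptt tp tq (ntPos i lt) E')

    ttc : ∀ p q → InT p → InT q → p ≢ q → expandedᵇ (contract H) p q ≡ H ∋[ p , q ]
    ttc p q tp tq pq = trans (expandedᵇ-tt (contract H) p q tp tq pq r x rp rq ex)
        (trans (lookup-tabulate² (contractedᵇ H) t (π x)) (trans (contractedᵇ-tz H (π x) (πNT x nX)) (trans (cong (touchesᵇ H) (eπNT x nX))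
          (boolEq (λ h → ttf p q tp tq pq r x tr rp rq ex (TKx r x tr ex h)) (ttg p q tp tq r x tr rp rq ex)))))
      where
      r = proj₁ (InT-third tp tq pq)
      tr : InT r
      tr = proj₁ (proj₂ (InT-third tp tq pq))
      rp : r ≢ p
      rp = proj₁ (proj₂ (proj₂ (InT-third tp tq pq)))
      rq : r ≢ q
      rq = proj₂ (proj₂ (proj₂ (InT-third tp tq pq)))
      x = proj₁ (pendantAt r tr)
      ex : Pendant u v w a b c r x
      ex = proj₂ (pendantAt r tr)
      nX = Pendant-OutT ex

    pw' : ∀ p q → InT p ⊎ OutT p → InT q ⊎ OutT q → expandedᵇ (contract H) p q ≡ H ∋[ p , q ]
    pw' p q (inj₂ np) (inj₂ nq) = trans (expandedᵇ-oo (contract H) p q np nq) (trans (lookup-tabulate² (contractedᵇ H) (π p) (π q))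
         (trans (contractedᵇ-yz H _ _ (πNT p np) (πNT q nq)) (cong₂ (λ a' b' → H ∋[ a' , b' ]) (eπNT p np) (eπNT q nq))))
    pw' p q (inj₁ tp) (inj₂ nq) = trans (expandedᵇ-to (contract H) p q tp nq)
         (trans (cong (_∧ adj G ∋[ p , q ]) (trans (lookup-tabulate² (contractedᵇ H) t (π q)) (trans (contractedᵇ-tz H (π q) (πNT q nq)) (cong (touchesᵇ H) (eπNT q nq)))))
           (boolEq f g))
      where
      f : touchesᵇ H q ∧ adj G ∋[ p , q ] ≡ true → H ∋[ p , q ] ≡ true
      f h with ∧≡true⇒ {touchesᵇ H q} h
      ... | h1 , h2 with touchesᵇ-elim H q h1
      ...   | r , tr , hr = H-sym (subst (λ z → H ∋[ q , z ] ≡ true) (sym (Pendant-base-unique (pendantOf q p nq tp (Adj-sym {G = G} h2)) (pendantOf q r nq tr (H⇒Adj hr)))) hr)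
      g : H ∋[ p , q ] ≡ true → touchesᵇ H q ∧ adj G ∋[ p , q ] ≡ true
      g h = ∧-intro (touchesᵇ-intro H tp (H-sym h)) (H⇒Adj h)
    pw' p q (inj₂ np) (inj₁ tq) = trans (expandedᵇ-ot (contract H) p q np tq)
         (trans (cong (_∧ adj G ∋[ p , q ]) (trans (lookup-tabulate² (contractedᵇ H) (π p) t) (trans (contractedᵇ-yt H (π p) (πNT p np)) (cong (touchesᵇ H) (eπNT p np)))))
           (boolEq f g))
      where
      f : touchesᵇ H p ∧ adj G ∋[ p , q ] ≡ true → H ∋[ p , q ] ≡ true
      f h with ∧≡true⇒ {touchesᵇ H p} h
      ... | h1 , h2 with touchesᵇ-elim H p h1
      ...   | r , tr , hr = subst (λ z → H ∋[ p , z ] ≡ true) (sym (Pendant-base-unique (pendantOf p q np tq h2) (pendantOf p r np tr (H⇒Adj hr)))) hr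
      g : H ∋[ p , q ] ≡ true → touchesᵇ H p ∧ adj G ∋[ p , q ] ≡ true
      g h = ∧-intro (touchesᵇ-intro H tq h) (H⇒Adj h)
    pw' p q (inj₁ tp) (inj₁ tq) = decElim (p F.≟ q) (λ { refl → trans (expandedᵇ-irrefl (contract H) p tp) (sym (H-irrefl p)) }) (ttc p q tp tq)

    expand∘contract-tour : expand (contract H) ≡ H
    expand∘contract-tour = tabulate²-lookup H (expandedᵇ (contract H)) (λ p q → pw' p q (InT? p) (InT? q))

  u≢w : u ≢ w
  u≢w h = w≢u (sym h)

  TFof : ∀ H → IsHamCycle G H → TriangleFirst G H u v w
  TFof H hc = triangleFirst (fromIsHamCycle hc) h4 u v w a c b Nu Nv Nw a≢v a≢w c≢w b≢v v≢w u≢v u≢w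

  contract-isHam : ∀ H → IsHamCycle G H → IsHamCycle G' (contract H)
  contract-isHam H hc = let (cy , t0 , t1 , t2) = TFof H hc in ContractTour.isHamCycle H cy t0 t1 t2

  expand∘contract : ∀ H → IsHamCycle G H → expand (contract H) ≡ H
  expand∘contract H hc = let (cy , t0 , t1 , t2) = TFof H hc in ExpandContract.expand∘contract-tour H cy t0 t1 t2

  expand-isHam : ∀ H' → IsHamCycle G' H' → IsHamCycle G (expand H')
  expand-isHam H' hc' = ExpandTour.isHamCycle H' (TourProperties.rotate cy0 (proj₁ sr)) (proj₂ (proj₂ sr))
    where
    cy0 = fromIsHamCycle hc'
    sr = TourProperties.s-surjective cy0 t

  contract∘expand : ∀ H' → IsHamCycle G' H' → contract (expand H') ≡ H'
  contract∘expand H' hc' = contract∘expand-tour H' (fromIsHamCycle hc')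

  reduction : Hamiltonian G → CubicReduction G
  reduction (C₀ , h) = G' , G'-cubic , (contract C₀ , contract-isHam C₀ h) , (contract , expand , contract-isHam , expand-isHam , expand∘contract , contract∘expand)

triangle-contraction : ∀ {n} (G : Graph n) → Cubic G → Hamiltonian G →
  ∀ u v w (uv : Adj G u v) (vw : Adj G v w) (wu : Adj G w u)
  (U : ThirdNbr G u v w) (V : ThirdNbr G v u w) (W : ThirdNbr G w u v) →
  ThirdNbr.nbr U ≢ ThirdNbr.nbr W → ThirdNbr.nbr U ≢ ThirdNbr.nbr V → ThirdNbr.nbr W ≢ ThirdNbr.nbr V →
  5 ≤ n → CubicReduction G
triangle-contraction G cub ham u v w uv vw wu U V W a≢b a≢c b≢c (s≤s (s≤s (s≤s (s≤s (s≤s {n = k} z≤n))))) =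
  Contraction.reduction (suc k) G cub u v w uv vw wu U V W a≢b a≢c b≢c (s≤s z≤n) ham

module TriangleCases {n} (G : Graph n) (cub : Cubic G) (u v w : Fin n)
  (uv : Adj G u v) (vw : Adj G v w) (wu : Adj G w u) (C₀ : EdgeSet n) (hC₀ : IsHamCycle G C₀) where

  u≢v : u ≢ v
  u≢v = Adj⇒≢ {G = G} uv
  v≢w : v ≢ w
  v≢w = Adj⇒≢ {G = G} vw
  w≢u : w ≢ u
  w≢u = Adj⇒≢ {G = G} wu

  U : ThirdNbr G u v w
  U = cubic-thirdNbr G cub u v w uv (Adj-sym {G = G} wu) v≢w
  V : ThirdNbr G v u w
  V = cubic-thirdNbr G cub v u w (Adj-sym {G = G} uv) vw (≢-sym w≢u)
  W : ThirdNbr G w u v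
  W = cubic-thirdNbr G cub w u v wu (Adj-sym {G = G} vw) u≢v

  open ThirdNbr U using () renaming (nbr to a; x~nbr to ua; nbr≢y to a≢v; nbr≢z to a≢w; nbrs to Nu)
  open ThirdNbr V using () renaming (nbr to c; x~nbr to vc; nbr≢y to c≢u; nbr≢z to c≢w; nbrs to Nv)
  open ThirdNbr W using () renaming (nbr to b; x~nbr to wb; nbr≢y to b≢u; nbr≢z to b≢v; nbrs to Nw)

  u≢a : u ≢ a
  u≢a = Adj⇒≢ {G = G} ua
  v≢c : v ≢ c
  v≢c = Adj⇒≢ {G = G} vc
  w≢b : w ≢ b
  w≢b = Adj⇒≢ {G = G} wb

  4≤n : 4 ≤ n
  4≤n = distinct⇒length≤ {xs = u ∷ v ∷ w ∷ a ∷ []}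
    ((u≢v ∷ ≢-sym w≢u ∷ u≢a ∷ []) ∷ (v≢w ∷ ≢-sym a≢v ∷ []) ∷ (≢-sym a≢w ∷ []) ∷ [] ∷ [])

  5≤n : a ≢ b → 5 ≤ n
  5≤n a≢b = distinct⇒length≤ {xs = u ∷ v ∷ w ∷ a ∷ b ∷ []}
    ((u≢v ∷ ≢-sym w≢u ∷ u≢a ∷ ≢-sym b≢u ∷ []) ∷ (v≢w ∷ ≢-sym a≢v ∷ ≢-sym b≢v ∷ []) ∷
     (≢-sym a≢w ∷ w≢b ∷ []) ∷ (a≢b ∷ []) ∷ [] ∷ [])

  tour₀ : Tour G C₀
  tour₀ = fromIsHamCycle hC₀

  switch : CrossedChords G C₀ → TwoEdgeSwitch G C₀ ⊎ CubicReduction G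
  switch (tour , chord₀₂ , chord₁₃) = inj₁ (crossedChords⇒switch tour 4≤n chord₀₂ chord₁₃)

  switch-or-reduce : TwoEdgeSwitch G C₀ ⊎ CubicReduction G
  switch-or-reduce with a F.≟ c | a F.≟ b | b F.≟ c
  ... | yes a≡c | _ | _ = switch (diamond⇒CrossedChords tour₀ 4≤n u v w a b
          uv (Adj-sym {G = G} wu) ua vw (subst (Adj G v) (sym a≡c) vc) wb
          Nu (subst (NbrsAmong G v u w) (sym a≡c) Nv) u≢v v≢w a≢v b≢u b≢v (≢-sym w≢b))
  ... | no _ | yes a≡b | _ = switch (diamond⇒CrossedChords tour₀ 4≤n u w v a c
          (Adj-sym {G = G} wu) uv ua (Adj-sym {G = G} vw) (subst (Adj G w) (sym a≡b) wb) vc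
          (NbrsAmong-swap₁₂ {G = G} Nu) (subst (NbrsAmong G w u v) (sym a≡b) Nw) (≢-sym w≢u) (≢-sym v≢w) a≢w c≢u c≢w (≢-sym v≢c))
  ... | no _ | no _ | yes b≡c = switch (diamond⇒CrossedChords tour₀ 4≤n v w u c a
          vw (Adj-sym {G = G} uv) vc wu (subst (Adj G w) b≡c wb) ua
          (NbrsAmong-swap₁₂ {G = G} Nv) (NbrsAmong-swap₁₂ {G = G} (subst (NbrsAmong G w u v) b≡c Nw)) v≢w w≢u c≢w a≢v a≢w (≢-sym u≢a))
  ... | no a≢c | no a≢b | no b≢c =
          inj₂ (triangle-contraction G cub (C₀ , hC₀) u v w uv vw wu U V W a≢b a≢c b≢c (5≤n a≢b))

lemma1 : (n : ℕ) (G : Graph n) → Cubic G → Hamiltonian G → HasTriangle G →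
    (C₀ : EdgeSet n) → IsHamCycle G C₀ →
    (Σ (EdgeSet n) λ C₁ → IsHamCycle G C₁ × C₁ ≢ C₀ × newEdges C₁ C₀ ≡ 2)
    ⊎ (Σ (Graph (n ∸ 2)) λ G' → Cubic G' × Hamiltonian G' × HamBijection G G')
lemma1 n G cub _ (u , v , w , uv , vw , wu) C₀ hC₀ = TriangleCases.switch-or-reduce G cub u v w uv vw wu C₀ hC₀
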